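{- Let $A\geq a\geq 1$ and $r\geq 2$ be integers, and let $N\widetilde{mes}_{r,A,a}$ be the set of overpartitions $\pi$ such that all parts of $\pi$ of size $\equiv a\pmod A$ and less than $\widetilde{mes}_{r,A,a}(\pi)$ are non-overlined. Then \[ \sum_{\pi \in N\widetilde{mes}_{r,A,a}}z^{\widetilde{mes}_{r,A,a}(\pi)}q^{|\pi|}=\frac{(-q;q)_{\infty }}{(q;q)_{\infty}}\sum_{k=0}^{\infty }z^{kA+a}\bigg[\frac{q^{(r-1)[A\binom{k}{2}+ka]}}{(-q^{a};q^{A})_{k+1 }}-\frac{q^{(r-1)[A\binom{k+1}{2}+(k+1)a]}}{(-q^{a};q^{A})_{k+1}}\bigg]. \]
   Context: An overpartition is a partition (finite non-increasing sequence of positive integers) in which the first occurrence of each part value may be overlined; $|\pi|$ is the sum of parts. A part is of size $t$ if it equals $t$ or $\overline{t}$. $(a;q)_\infty=\prod_{i\geq0}(1-aq^i)$, $(a;q)_n=(a;q)_\infty/(aq^n;q)_\infty$; $|q|<1$, $z$ a formal variable. For $r\geq2$, $\widetilde{mes}_{r,A,a}(\pi)$ is the smallest positive integer $m\equiv a\pmod A$ such that $\pi$ has no overlined part $\overline{m}$ and $\pi$ has fewer than $r-1$ non-overlined parts equal to $m$. -}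

module Defs where

open import Data.Nat as ℕ using (ℕ; zero; suc; _≤_; _<_; _∸_; _≡ᵇ_)
open import Data.Nat.Combinatorics using (_C_)
open import Data.Integer as ℤ using (ℤ; +_; -_)
open import Data.Bool using (Bool; true; false; if_then_else_)
open import Data.Product using (_×_; _,_; ∃-syntax)
open import Data.List using (List; []; _∷_; map; foldr; upTo)
open import Data.List.Relation.Unary.All using (All)
open import Data.List.Relation.Unary.Linked using (Linked)
open import Data.List.Membership.Propositional using (_∈_; _∉_)
open import Data.Sum using (_⊎_)
open import Data.Empty using (⊥)
open import Relation.Binary.PropositionalEquality using (_≡_)

-- Overpartitions
-- An overpartition is represented as a list of parts (t , b), where t is
-- the size and b = true means the part is overlined.  Canonical form:
-- parts positive, sizes non-increasing, and among parts of equal size only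
-- the first one may be overlined.

Part : Set
Part = ℕ × Bool

size : Part → ℕ
size (t , _) = t

Step : Part → Part → Set
Step (t , b) (t′ , b′) = t′ < t ⊎ (t′ ≡ t × b′ ≡ false)

IsOverpartition : List Part → Set
IsOverpartition π = All (λ p → 1 ≤ size p) π × Linked Step π

weight : List Part → ℕ
weight = foldr (λ p s → size p ℕ.+ s) 0

countNon : ℕ → List Part → ℕ
countNon m [] = 0
countNon m ((t , true) ∷ π) = countNon m π
countNon m ((t , false) ∷ π) = (if t ≡ᵇ m then 1 else 0) ℕ.+ countNon m π

-- m ≡ a (mod A) with m positive; since 1 ≤ a ≤ A these are m = k*A + a, k ≥ 0
CongPos : ℕ → ℕ → ℕ → Set
CongPos A a m = ∃[ k ] m ≡ k ℕ.* A ℕ.+ a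

Avail : ℕ → List Part → ℕ → Set
Avail r π m = ((m , true) ∉ π) × (countNon m π < r ∸ 1)

record IsMes (r A a : ℕ) (π : List Part) (m : ℕ) : Set where
  field
    cong      : CongPos A a m
    avail     : Avail r π m
    minimal   : ∀ m′ → CongPos A a m′ → m′ < m → Avail r π m′ → ⊥

InNmes : ℕ → ℕ → ℕ → List Part → Set
InNmes A a m π = ∀ t b → (t , b) ∈ π → CongPos A a t → t < m → b ≡ false

FPS : Set
FPS = ℕ → ℤ

sumℤ : List ℤ → ℤ
sumℤ = foldr ℤ._+_ (+ 0)

_⊕_ : FPS → FPS → FPS
(f ⊕ g) n = f n ℤ.+ g n

_⊖_ : FPS → FPS → FPS
(f ⊖ g) n = f n ℤ.- g n

_⊛_ : FPS → FPS → FPS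
(f ⊛ g) n = sumℤ (map (λ i → f i ℤ.* g (n ∸ i)) (upTo (suc n)))

oneS : FPS
oneS zero = + 1
oneS (suc _) = + 0

mono : ℤ → ℕ → FPS
mono c e n = if e ≡ᵇ n then c else + 0

prodS : List FPS → FPS
prodS = foldr _⊛_ oneS

-- 1/(1 - c q^d) = Σ_j c^j q^{d j}   (used for d ≥ 1)
geom : ℤ → ℕ → FPS
geom c d n = sumℤ (map (λ j → if d ℕ.* j ≡ᵇ n then c ℤ.^ j else + 0) (upTo (suc n)))

-- infinite product ∏_{i ≥ 1} F i, for F i ≡ 1 mod q^i:
-- the coefficient of q^n is that of the finite product ∏_{i=1}^{n} F i
infProd : (ℕ → FPS) → FPS
infProd F n = prodS (map (λ i → F (suc i)) (upTo n)) n

negQPochInf : FPS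
negQPochInf = infProd (λ i → oneS ⊕ mono (+ 1) i)

invQPochInf : FPS
invQPochInf = infProd (λ i → geom (+ 1) i)

invNegPoch : ℕ → ℕ → ℕ → FPS
invNegPoch A a k = prodS (map (λ i → geom (- + 1) (a ℕ.+ i ℕ.* A)) (upTo (suc k)))

-- the summand (coefficient of z^{kA+a}) of the right-hand side
rhsTerm : ℕ → ℕ → ℕ → ℕ → FPS
rhsTerm r A a k =
  (negQPochInf ⊛ invQPochInf) ⊛
  ((mono (+ 1) ((r ∸ 1) ℕ.* (A ℕ.* (k C 2) ℕ.+ k ℕ.* a))
    ⊖ mono (+ 1) ((r ∸ 1) ℕ.* (A ℕ.* (suc k C 2) ℕ.+ suc k ℕ.* a)))
   ⊛ invNegPoch A a k)

-- coefficient of z^m in the right-hand side: Σ_{k ≥ 0, kA+a = m} rhsTerm k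
-- (any such k satisfies k ≤ m since A ≥ 1)
rhsCoeff : ℕ → ℕ → ℕ → ℕ → FPS
rhsCoeff r A a m n =
  sumℤ (map (λ k → if k ℕ.* A ℕ.+ a ≡ᵇ m then rhsTerm r A a k n else + 0) (upTo (suc m)))

-- Fix m = kA + a. An overpartition π has mes(π) = m and lies in N mes exactly when, size by
-- size, it has fewer than r − 1 parts of size m, at least r − 1 parts of each smaller size
-- a + jA (j < k), all of these non-overlined, and arbitrary parts of every other size.
-- Building overpartitions block by block from the largest size down therefore counts them by
-- the product over all sizes t of the block generating functions (1 + q^t)/(1 − q^t),
-- q^{(r−1)t}/(1 − q^t) and (1 − q^{(r−1)m})/(1 − q^m) respectively. Dividing each constrained
-- factor by (1 + q^t)/(1 − q^t) leaves (−q;q)_∞/(q;q)_∞ times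
-- q^{(r−1)Σ_{j<k}(a+jA)} (1 − q^{(r−1)m}) / (−q^a;q^A)_{k+1}, the k-th summand of the sum.

module Submission where

open import Defs

open import Data.Bool using (Bool; true; false; if_then_else_; _∨_)
import Data.Bool.Properties as BoolP
open import Data.Integer as ℤ using (ℤ; +_; -_; _+_; _-_; _*_)
import Data.Integer.Properties as ℤP
open import Data.Integer.Tactic.RingSolver using (solve-∀)
open import Data.List using (List; []; _∷_; _++_; head; map; filter; concatMap; replicate; length; upTo; downFrom; applyUpTo)
import Data.List.Properties as LP
open import Data.List.Membership.Propositional using (_∈_; _∉_; find; lose)
open import Data.List.Membership.Propositional.Properties
  using ( ∈-map⁺; ∈-map⁻; ∈-++⁺ˡ; ∈-++⁺ʳ; ∈-++⁻; ∈-upTo⁺; ∈-upTo⁻; ∈-downFrom⁺; ∈-downFrom⁻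
        ; ∈-filter⁺; ∈-filter⁻; ∈-concatMap⁺; ∈-concatMap⁻)
open import Data.List.Membership.Propositional.Properties.WithK using (unique∧set⇒bag)
open import Data.List.Relation.Binary.BagAndSetEquality using (∼bag⇒↭)
open import Data.List.Relation.Binary.Permutation.Propositional as ↭ using (_↭_)
open import Data.List.Relation.Binary.Permutation.Propositional.Properties as PermProp using (↭-length)
open import Data.List.Relation.Unary.All as All using (All; []; _∷_)
open import Data.List.Relation.Unary.AllPairs using ([]; _∷_)
open import Data.List.Relation.Unary.Any using (here; there)
open import Data.List.Relation.Unary.Linked as Linked using (Linked; []; _∷_)
open import Data.List.Relation.Unary.Linked.Properties using (Linked⇒All)
open import Data.List.Relation.Unary.Unique.Propositional using (Unique)
import Data.List.Relation.Unary.Unique.Propositional.Properties as Unique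
open import Data.Maybe using (just)
open import Data.Maybe.Relation.Binary.Connected as Connected using (Connected)
open import Data.Nat as ℕ using (ℕ; zero; suc; _≤_; _<_; _∸_; _≡ᵇ_; _<?_; z≤n; s≤s)
open import Data.Nat.Combinatorics using (_C_; nC1≡n; nCk+nC[k+1]≡[n+1]C[k+1]; k>n⇒nCk≡0)
open import Data.Nat.ListAction using (sum)
import Data.Nat.Properties as ℕP
import Data.Nat.Tactic.RingSolver as ℕSolver
open import Data.Product using (_×_; _,_; proj₁; proj₂; ∃-syntax)
open import Data.Sum using (inj₁; inj₂)
open import Data.Unit using (⊤; tt)
open import Function using (_∘_)
open import Function.Bundles using (_⇔_; mk⇔)
open import Level using (0ℓ)
open import Relation.Binary.Bundles using (Setoid)
import Relation.Binary.Reasoning.Setoid as SetoidReasoning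
open import Relation.Binary.PropositionalEquality
open import Relation.Nullary using (¬_; Dec; does; yes; no; contradiction)
open import Relation.Nullary.Decidable using (dec-true; dec-false)
open import Relation.Unary using (Decidable)

≡ᵇ-true : ∀ {x y} → x ≡ y → (x ≡ᵇ y) ≡ true
≡ᵇ-true {x} {y} = dec-true (x ℕ.≟ y)

≡ᵇ-false : ∀ {x y} → x ≢ y → (x ≡ᵇ y) ≡ false
≡ᵇ-false {x} {y} = dec-false (x ℕ.≟ y)

-- Finite sums

∑ : ℕ → (ℕ → ℤ) → ℤ
∑ zero f = + 0
∑ (suc n) f = f 0 + ∑ n (f ∘ suc)

sumℤ-map-upTo : ∀ n f → sumℤ (map f (upTo n)) ≡ ∑ n f
sumℤ-map-upTo n f = trans (cong sumℤ (LP.map-upTo f n)) (sumℤ-applyUpTo n f)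
  where
  sumℤ-applyUpTo : ∀ n f → sumℤ (applyUpTo f n) ≡ ∑ n f
  sumℤ-applyUpTo zero f = refl
  sumℤ-applyUpTo (suc n) f = cong (_+_ (f 0)) (sumℤ-applyUpTo n (f ∘ suc))

∑-cong : ∀ n {f g} → (∀ i → i < n → f i ≡ g i) → ∑ n f ≡ ∑ n g
∑-cong zero f≡g = refl
∑-cong (suc n) f≡g = cong₂ _+_ (f≡g 0 (s≤s z≤n)) (∑-cong n (λ i i<n → f≡g (suc i) (s≤s i<n)))

∑-zero : ∀ n {f} → (∀ i → i < n → f i ≡ + 0) → ∑ n f ≡ + 0
∑-zero zero f≡0 = refl
∑-zero (suc n) f≡0 = cong₂ _+_ (f≡0 0 (s≤s z≤n)) (∑-zero n (λ i i<n → f≡0 (suc i) (s≤s i<n)))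

∑-single : ∀ n e f → e < n → (∀ i → i < n → i ≢ e → f i ≡ + 0) → ∑ n f ≡ f e
∑-single (suc n) zero f _ f≡0 =
  trans (cong (_+_ (f 0)) (∑-zero n (λ i i<n → f≡0 (suc i) (s≤s i<n) λ ())))
        (ℤP.+-identityʳ (f 0))
∑-single (suc n) (suc e) f (s≤s e<n) f≡0 =
  trans (cong (_+ ∑ n (f ∘ suc)) (f≡0 0 (s≤s z≤n) λ ()))
        (trans (ℤP.+-identityˡ _)
               (∑-single n e (f ∘ suc) e<n (λ i i<n i≢e → f≡0 (suc i) (s≤s i<n) (i≢e ∘ ℕP.suc-injective))))

∑-+ : ∀ n f g → ∑ n (λ i → f i + g i) ≡ ∑ n f + ∑ n g
∑-+ zero f g = refl
∑-+ (suc n) f g = trans (cong (_+_ (f 0 + g 0)) (∑-+ n (f ∘ suc) (g ∘ suc)))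
                        (interchange (f 0) (g 0) _ _)
  where
  interchange : ∀ (a b c d : ℤ) → (a + b) + (c + d) ≡ (a + c) + (b + d)
  interchange = solve-∀

∑-neg : ∀ n f → ∑ n (λ i → - f i) ≡ - ∑ n f
∑-neg zero f = refl
∑-neg (suc n) f = trans (cong (_+_ (- f 0)) (∑-neg n (f ∘ suc)))
                        (sym (ℤP.neg-distrib-+ (f 0) _))

∑-*ˡ : ∀ n c f → ∑ n (λ i → c * f i) ≡ c * ∑ n f
∑-*ˡ zero c f = sym (ℤP.*-zeroʳ c)
∑-*ˡ (suc n) c f = trans (cong (_+_ (c * f 0)) (∑-*ˡ n c (f ∘ suc)))
                         (sym (ℤP.*-distribˡ-+ c (f 0) _))

∑-*ʳ : ∀ n c f → ∑ n (λ i → f i * c) ≡ ∑ n f * c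
∑-*ʳ n c f = trans (∑-cong n (λ i _ → ℤP.*-comm (f i) c))
                   (trans (∑-*ˡ n c f) (ℤP.*-comm c _))

∑-snoc : ∀ n f → ∑ (suc n) f ≡ ∑ n f + f n
∑-snoc zero f = trans (ℤP.+-identityʳ (f 0)) (sym (ℤP.+-identityˡ (f 0)))
∑-snoc (suc n) f = trans (cong (_+_ (f 0)) (∑-snoc n (f ∘ suc)))
                         (sym (ℤP.+-assoc (f 0) _ _))

∑-extend : ∀ n k f → (∀ i → n ≤ i → f i ≡ + 0) → ∑ (n ℕ.+ k) f ≡ ∑ n f
∑-extend n zero f _ = cong (λ l → ∑ l f) (ℕP.+-identityʳ n)
∑-extend n (suc k) f f≡0 = begin
  ∑ (n ℕ.+ suc k) f         ≡⟨ cong (λ l → ∑ l f) (ℕP.+-suc n k) ⟩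
  ∑ (suc (n ℕ.+ k)) f       ≡⟨ ∑-snoc (n ℕ.+ k) f ⟩
  ∑ (n ℕ.+ k) f + f (n ℕ.+ k) ≡⟨ cong₂ _+_ (∑-extend n k f f≡0) (f≡0 (n ℕ.+ k) (ℕP.m≤m+n n k)) ⟩
  ∑ n f + + 0               ≡⟨ ℤP.+-identityʳ _ ⟩
  ∑ n f                     ∎
  where open ≡-Reasoning

∑-reverse : ∀ n f → ∑ (suc n) f ≡ ∑ (suc n) (λ i → f (n ∸ i))
∑-reverse zero f = refl
∑-reverse (suc n) f = begin
  f 0 + ∑ (suc n) (f ∘ suc)                    ≡⟨ cong (_+_ (f 0)) (∑-reverse n (f ∘ suc)) ⟩
  f 0 + ∑ (suc n) (λ i → f (suc (n ∸ i)))      ≡⟨ ℤP.+-comm (f 0) _ ⟩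
  ∑ (suc n) (λ i → f (suc (n ∸ i))) + f 0      ≡⟨ cong₂ _+_ (∑-cong (suc n) λ i i≤n →
                                                     cong f (sym (ℕP.+-∸-assoc 1 (ℕP.≤-pred i≤n))))
                                                  (cong f (sym (ℕP.n∸n≡0 (suc n)))) ⟩
  ∑ (suc n) (λ i → f (suc n ∸ i)) + f (suc n ∸ suc n) ≡⟨ ∑-snoc (suc n) (λ i → f (suc n ∸ i)) ⟨
  ∑ (suc (suc n)) (λ i → f (suc n ∸ i))        ∎
  where open ≡-Reasoning

-- Both sides sum K j (i ∸ j) (n ∸ i) over j ≤ i ≤ n, grouped by i and by j respectively.
∑-triangle : ∀ n (K : ℕ → ℕ → ℕ → ℤ) →
  ∑ (suc n) (λ i → ∑ (suc i) (λ j → K j (i ∸ j) (n ∸ i))) ≡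
  ∑ (suc n) (λ j → ∑ (suc (n ∸ j)) (λ l → K j l (n ∸ j ∸ l)))
∑-triangle zero K = refl
∑-triangle (suc n) K = begin
  (K 0 0 (suc n) + + 0) + ∑ (suc n) (λ i → K 0 (suc i) (n ∸ i) + inner i)
    ≡⟨ cong (_+_ (K 0 0 (suc n) + + 0)) (∑-+ (suc n) (λ i → K 0 (suc i) (n ∸ i)) inner) ⟩
  (K 0 0 (suc n) + + 0) + (first-row + ∑ (suc n) inner)
    ≡⟨ cong (λ s → (K 0 0 (suc n) + + 0) + (first-row + s)) (∑-triangle n (K ∘ suc)) ⟩
  (K 0 0 (suc n) + + 0) + (first-row + other-rows)
    ≡⟨ reassoc (K 0 0 (suc n)) first-row other-rows ⟩
  (K 0 0 (suc n) + first-row) + other-rows ∎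
  where
  open ≡-Reasoning
  inner : ℕ → ℤ
  inner i = ∑ (suc i) (λ j → K (suc j) (i ∸ j) (n ∸ i))
  first-row other-rows : ℤ
  first-row = ∑ (suc n) (λ l → K 0 (suc l) (n ∸ l))
  other-rows = ∑ (suc n) (λ j → ∑ (suc (n ∸ j)) (λ l → K (suc j) l (n ∸ j ∸ l)))
  reassoc : ∀ (a b c : ℤ) → (a + + 0) + (b + c) ≡ (a + b) + c
  reassoc = solve-∀

-- Power series

-- A record rather than a pointwise equation, so that f and g can be inferred from a proof.
infix 4 _≈_
record _≈_ (f g : FPS) : Set where
  constructor coeffwise
  field coeff : ∀ n → f n ≡ g n
open _≈_ public

≈-setoid : Setoid 0ℓ 0ℓ
≈-setoid = record
  { Carrier = FPS
  ; _≈_ = _≈_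
  ; isEquivalence = record
    { refl = coeffwise λ _ → refl
    ; sym = λ f≈g → coeffwise (sym ∘ coeff f≈g)
    ; trans = λ f≈g g≈h → coeffwise λ n → trans (coeff f≈g n) (coeff g≈h n)
    }
  }

open Setoid ≈-setoid public using () renaming (refl to ≈-refl; reflexive to ≡⇒≈; sym to ≈-sym; trans to ≈-trans)
module ≈-Reasoning = SetoidReasoning ≈-setoid

⊛-coeff : ∀ f g n → (f ⊛ g) n ≡ ∑ (suc n) (λ i → f i * g (n ∸ i))
⊛-coeff f g n = sumℤ-map-upTo (suc n) (λ i → f i * g (n ∸ i))

⊛-cong-upto : ∀ {f f′ g g′} n → (∀ i → i ≤ n → f i ≡ f′ i) → (∀ i → i ≤ n → g i ≡ g′ i) →
              (f ⊛ g) n ≡ (f′ ⊛ g′) n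
⊛-cong-upto {f} {f′} {g} {g′} n f≡f′ g≡g′ = begin
  (f ⊛ g) n                           ≡⟨ ⊛-coeff f g n ⟩
  ∑ (suc n) (λ i → f i * g (n ∸ i))   ≡⟨ ∑-cong (suc n) (λ i i≤n → cong₂ _*_ (f≡f′ i (ℕP.≤-pred i≤n))
                                                                          (g≡g′ (n ∸ i) (ℕP.m∸n≤m n i))) ⟩
  ∑ (suc n) (λ i → f′ i * g′ (n ∸ i)) ≡⟨ ⊛-coeff f′ g′ n ⟨
  (f′ ⊛ g′) n                         ∎
  where open ≡-Reasoning

⊛-cong : ∀ {f f′ g g′} → f ≈ f′ → g ≈ g′ → f ⊛ g ≈ f′ ⊛ g′
⊛-cong f≈f′ g≈g′ = coeffwise λ n → ⊛-cong-upto n (λ i _ → coeff f≈f′ i) (λ i _ → coeff g≈g′ i)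

⊛-congˡ : ∀ {f f′} g → f ≈ f′ → f ⊛ g ≈ f′ ⊛ g
⊛-congˡ g f≈f′ = ⊛-cong f≈f′ (≈-refl {g})

⊛-congʳ : ∀ f {g g′} → g ≈ g′ → f ⊛ g ≈ f ⊛ g′
⊛-congʳ f g≈g′ = ⊛-cong (≈-refl {f}) g≈g′

⊛-comm : ∀ f g → f ⊛ g ≈ g ⊛ f
⊛-comm f g = coeffwise λ n → begin
  (f ⊛ g) n
    ≡⟨ ⊛-coeff f g n ⟩
  ∑ (suc n) (λ i → f i * g (n ∸ i))
    ≡⟨ ∑-reverse n (λ i → f i * g (n ∸ i)) ⟩
  ∑ (suc n) (λ i → f (n ∸ i) * g (n ∸ (n ∸ i)))
    ≡⟨ ∑-cong (suc n) (λ i i≤n → trans (cong (λ j → f (n ∸ i) * g j) (ℕP.m∸[m∸n]≡n (ℕP.≤-pred i≤n)))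
                                       (ℤP.*-comm (f (n ∸ i)) (g i))) ⟩
  ∑ (suc n) (λ i → g i * f (n ∸ i))
    ≡⟨ ⊛-coeff g f n ⟨
  (g ⊛ f) n ∎
  where open ≡-Reasoning

⊛-assoc : ∀ f g h → (f ⊛ g) ⊛ h ≈ f ⊛ (g ⊛ h)
⊛-assoc f g h = coeffwise λ n → begin
  ((f ⊛ g) ⊛ h) n
    ≡⟨ ⊛-coeff (f ⊛ g) h n ⟩
  ∑ (suc n) (λ i → (f ⊛ g) i * h (n ∸ i))
    ≡⟨ ∑-cong (suc n) (λ i _ → trans (cong (_* h (n ∸ i)) (⊛-coeff f g i))
                                     (sym (∑-*ʳ (suc i) (h (n ∸ i)) (λ j → f j * g (i ∸ j))))) ⟩
  ∑ (suc n) (λ i → ∑ (suc i) (λ j → (f j * g (i ∸ j)) * h (n ∸ i)))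
    ≡⟨ ∑-cong (suc n) (λ i _ → ∑-cong (suc i) (λ j _ → ℤP.*-assoc (f j) (g (i ∸ j)) (h (n ∸ i)))) ⟩
  ∑ (suc n) (λ i → ∑ (suc i) (λ j → f j * (g (i ∸ j) * h (n ∸ i))))
    ≡⟨ ∑-triangle n (λ j l p → f j * (g l * h p)) ⟩
  ∑ (suc n) (λ j → ∑ (suc (n ∸ j)) (λ l → f j * (g l * h (n ∸ j ∸ l))))
    ≡⟨ ∑-cong (suc n) (λ j _ → trans (∑-*ˡ (suc (n ∸ j)) (f j) (λ l → g l * h (n ∸ j ∸ l)))
                                     (cong (f j *_) (sym (⊛-coeff g h (n ∸ j))))) ⟩
  ∑ (suc n) (λ j → f j * (g ⊛ h) (n ∸ j))
    ≡⟨ ⊛-coeff f (g ⊛ h) n ⟨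
  (f ⊛ (g ⊛ h)) n ∎
  where open ≡-Reasoning

⊛-distribʳ-⊕ : ∀ f g h → (f ⊕ g) ⊛ h ≈ (f ⊛ h) ⊕ (g ⊛ h)
⊛-distribʳ-⊕ f g h = coeffwise λ n → begin
  ((f ⊕ g) ⊛ h) n
    ≡⟨ ⊛-coeff (f ⊕ g) h n ⟩
  ∑ (suc n) (λ i → (f i + g i) * h (n ∸ i))
    ≡⟨ ∑-cong (suc n) (λ i _ → ℤP.*-distribʳ-+ (h (n ∸ i)) (f i) (g i)) ⟩
  ∑ (suc n) (λ i → f i * h (n ∸ i) + g i * h (n ∸ i))
    ≡⟨ ∑-+ (suc n) (λ i → f i * h (n ∸ i)) (λ i → g i * h (n ∸ i)) ⟩
  ∑ (suc n) (λ i → f i * h (n ∸ i)) + ∑ (suc n) (λ i → g i * h (n ∸ i))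
    ≡⟨ cong₂ _+_ (⊛-coeff f h n) (⊛-coeff g h n) ⟨
  ((f ⊛ h) ⊕ (g ⊛ h)) n ∎
  where open ≡-Reasoning

neg : FPS → FPS
neg f n = - f n

neg-⊛ : ∀ f g → neg f ⊛ g ≈ neg (f ⊛ g)
neg-⊛ f g = coeffwise λ n → begin
  (neg f ⊛ g) n                          ≡⟨ ⊛-coeff (neg f) g n ⟩
  ∑ (suc n) (λ i → - f i * g (n ∸ i))    ≡⟨ ∑-cong (suc n) (λ i _ → sym (ℤP.neg-distribˡ-* (f i) (g (n ∸ i)))) ⟩
  ∑ (suc n) (λ i → - (f i * g (n ∸ i)))  ≡⟨ ∑-neg (suc n) (λ i → f i * g (n ∸ i)) ⟩
  - ∑ (suc n) (λ i → f i * g (n ∸ i))    ≡⟨ cong -_ (⊛-coeff f g n) ⟨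
  neg (f ⊛ g) n                          ∎
  where open ≡-Reasoning

⊛-distribʳ-⊖ : ∀ f g h → (f ⊖ g) ⊛ h ≈ (f ⊛ h) ⊖ (g ⊛ h)
⊛-distribʳ-⊖ f g h = ≈-trans (⊛-distribʳ-⊕ f (neg g) h)
  (coeffwise λ n → cong (_+_ ((f ⊛ h) n)) (coeff (neg-⊛ g h) n))

⊛-identityˡ : ∀ f → oneS ⊛ f ≈ f
⊛-identityˡ f = coeffwise λ n → begin
  (oneS ⊛ f) n                             ≡⟨ ⊛-coeff oneS f n ⟩
  + 1 * f n + ∑ n (λ i → + 0 * f (n ∸ suc i)) ≡⟨ cong₂ _+_ (ℤP.*-identityˡ (f n)) (∑-zero n (λ _ _ → refl)) ⟩
  f n + + 0                                ≡⟨ ℤP.+-identityʳ (f n) ⟩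
  f n                                      ∎
  where open ≡-Reasoning

⊛-identityʳ : ∀ f → f ⊛ oneS ≈ f
⊛-identityʳ f = ≈-trans (⊛-comm f oneS) (⊛-identityˡ f)

⊛-interchange : ∀ f g h k → (f ⊛ g) ⊛ (h ⊛ k) ≈ (f ⊛ h) ⊛ (g ⊛ k)
⊛-interchange f g h k = begin
  (f ⊛ g) ⊛ (h ⊛ k) ≈⟨ ⊛-assoc f g (h ⊛ k) ⟩
  f ⊛ (g ⊛ (h ⊛ k)) ≈⟨ ⊛-congʳ f (⊛-assoc g h k) ⟨
  f ⊛ ((g ⊛ h) ⊛ k) ≈⟨ ⊛-congʳ f (⊛-congˡ k (⊛-comm g h)) ⟩
  f ⊛ ((h ⊛ g) ⊛ k) ≈⟨ ⊛-congʳ f (⊛-assoc h g k) ⟩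
  f ⊛ (h ⊛ (g ⊛ k)) ≈⟨ ⊛-assoc f h (g ⊛ k) ⟨
  (f ⊛ h) ⊛ (g ⊛ k) ∎
  where open ≈-Reasoning

-- Monomials and geometric series

mono-≡ : ∀ c e → mono c e e ≡ c
mono-≡ c e rewrite ≡ᵇ-true (refl {x = e}) = refl

mono-≢ : ∀ c {e n} → e ≢ n → mono c e n ≡ + 0
mono-≢ c e≢n rewrite ≡ᵇ-false e≢n = refl

mono-⊛-coeff : ∀ c e f n → e ≤ n → (mono c e ⊛ f) n ≡ c * f (n ∸ e)
mono-⊛-coeff c e f n e≤n = begin
  (mono c e ⊛ f) n                          ≡⟨ ⊛-coeff (mono c e) f n ⟩
  ∑ (suc n) (λ i → mono c e i * f (n ∸ i))  ≡⟨ ∑-single (suc n) e _ (s≤s e≤n)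
                                                 (λ i _ i≢e → cong (_* f (n ∸ i)) (mono-≢ c (i≢e ∘ sym))) ⟩
  mono c e e * f (n ∸ e)                    ≡⟨ cong (_* f (n ∸ e)) (mono-≡ c e) ⟩
  c * f (n ∸ e)                             ∎
  where open ≡-Reasoning

mono-⊛-coeff-< : ∀ c e f n → n < e → (mono c e ⊛ f) n ≡ + 0
mono-⊛-coeff-< c e f n n<e = trans (⊛-coeff (mono c e) f n)
  (∑-zero (suc n) λ i i≤n → cong (_* f (n ∸ i))
    (mono-≢ c λ e≡i → ℕP.<⇒≱ n<e (subst (_≤ n) (sym e≡i) (ℕP.≤-pred i≤n))))

mono-⊛-mono : ∀ x y → mono (+ 1) x ⊛ mono (+ 1) y ≈ mono (+ 1) (x ℕ.+ y)
mono-⊛-mono x y = coeffwise λ n → coeff-at n (x ℕP.≤? n)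
  where
  coeff-at : ∀ n → Dec (x ≤ n) → (mono (+ 1) x ⊛ mono (+ 1) y) n ≡ mono (+ 1) (x ℕ.+ y) n
  coeff-at n (no x≰n) = trans (mono-⊛-coeff-< (+ 1) x (mono (+ 1) y) n (ℕP.≰⇒> x≰n))
    (sym (mono-≢ (+ 1) λ x+y≡n → x≰n (subst (x ≤_) x+y≡n (ℕP.m≤m+n x y))))
  coeff-at n (yes x≤n) = trans (mono-⊛-coeff (+ 1) x (mono (+ 1) y) n x≤n)
    (trans (ℤP.*-identityˡ _) (cong (λ b → if b then + 1 else + 0) (shift (y ℕ.≟ n ∸ x))))
    where
    shift : Dec (y ≡ n ∸ x) → (y ≡ᵇ n ∸ x) ≡ (x ℕ.+ y ≡ᵇ n)
    shift (yes y≡n∸x) = trans (≡ᵇ-true y≡n∸x)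
      (sym (≡ᵇ-true (trans (cong (x ℕ.+_) y≡n∸x) (ℕP.m+[n∸m]≡n x≤n))))
    shift (no y≢n∸x) = trans (≡ᵇ-false y≢n∸x)
      (sym (≡ᵇ-false λ x+y≡n → y≢n∸x (trans (sym (ℕP.m+n∸m≡n x y)) (cong (_∸ x) x+y≡n))))

oneS≈mono0 : oneS ≈ mono (+ 1) 0
oneS≈mono0 = coeffwise λ { zero → refl ; (suc n) → refl }

geomTerm : ℤ → ℕ → ℕ → ℕ → ℤ
geomTerm c d n j = if d ℕ.* j ≡ᵇ n then c ℤ.^ j else + 0

geomTerm-zero : ∀ c d n → geomTerm c d n 0 ≡ oneS n
geomTerm-zero c d n rewrite ℕP.*-zeroʳ d with n
... | zero = refl
... | suc _ = refl

geomTerm-suc : ∀ c d n j → d ≤ n → geomTerm c d n (suc j) ≡ c * geomTerm c d (n ∸ d) j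
geomTerm-suc c d n j d≤n with d ℕ.* j ℕ.≟ n ∸ d
... | yes dj≡n∸d rewrite ≡ᵇ-true dj≡n∸d
                       | ≡ᵇ-true (trans (ℕP.*-suc d j) (trans (cong (d ℕ.+_) dj≡n∸d) (ℕP.m+[n∸m]≡n d≤n))) = refl
... | no dj≢n∸d rewrite ≡ᵇ-false dj≢n∸d
                      | ≡ᵇ-false {d ℕ.* suc j} {n} λ dsj≡n →
                          dj≢n∸d (trans (sym (ℕP.m+n∸m≡n d (d ℕ.* j))) (cong (_∸ d) (trans (sym (ℕP.*-suc d j)) dsj≡n)))
                      = sym (ℤP.*-zeroʳ c)

geomTerm-off : ∀ c d n j → d ℕ.* j ≢ n → geomTerm c d n j ≡ + 0
geomTerm-off c d n j dj≢n rewrite ≡ᵇ-false dj≢n = refl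

geomTerm-above : ∀ c d n j → 1 ≤ d → n < j → geomTerm c d n j ≡ + 0
geomTerm-above c d n j 1≤d n<j = geomTerm-off c d n j
  λ dj≡n → ℕP.<⇒≱ n<j (subst (j ≤_) dj≡n (ℕP.m≤n*m j d ⦃ ℕ.>-nonZero 1≤d ⦄))

geom-as-∑ : ∀ c d N n → 1 ≤ d → n < N → geom c d n ≡ ∑ N (geomTerm c d n)
geom-as-∑ c d N n 1≤d n<N = begin
  geom c d n                                ≡⟨ sumℤ-map-upTo (suc n) (geomTerm c d n) ⟩
  ∑ (suc n) (geomTerm c d n)                ≡⟨ ∑-extend (suc n) (N ∸ suc n) (geomTerm c d n)
                                                 (λ j n<j → geomTerm-above c d n j 1≤d n<j) ⟨
  ∑ (suc n ℕ.+ (N ∸ suc n)) (geomTerm c d n) ≡⟨ cong (λ l → ∑ l (geomTerm c d n)) (ℕP.m+[n∸m]≡n n<N) ⟩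
  ∑ N (geomTerm c d n)                      ∎
  where open ≡-Reasoning

geom-below : ∀ c d n → 1 ≤ d → n < d → geom c d n ≡ oneS n
geom-below c d n 1≤d n<d = begin
  geom c d n                                    ≡⟨ geom-as-∑ c d (suc n) n 1≤d ℕP.≤-refl ⟩
  geomTerm c d n 0 + ∑ n (geomTerm c d n ∘ suc) ≡⟨ cong₂ _+_ (geomTerm-zero c d n)
                                                     (∑-zero n λ j _ → geomTerm-off c d n (suc j) λ dsj≡n →
                                                       ℕP.<⇒≱ n<d (subst (d ≤_) dsj≡n (ℕP.m≤m*n d (suc j))))  ⟩
  oneS n + + 0                                  ≡⟨ ℤP.+-identityʳ _ ⟩
  oneS n                                        ∎
  where open ≡-Reasoning

geom-step : ∀ c d n → 1 ≤ d → d ≤ n → geom c d n ≡ oneS n + c * geom c d (n ∸ d)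
geom-step c d n 1≤d d≤n = begin
  geom c d n                                    ≡⟨ geom-as-∑ c d (suc n) n 1≤d ℕP.≤-refl ⟩
  geomTerm c d n 0 + ∑ n (geomTerm c d n ∘ suc) ≡⟨ cong₂ _+_ (geomTerm-zero c d n)
                                                     (∑-cong n λ j _ → geomTerm-suc c d n j d≤n) ⟩
  oneS n + ∑ n (λ j → c * geomTerm c d (n ∸ d) j) ≡⟨ cong (_+_ (oneS n)) (∑-*ˡ n c (geomTerm c d (n ∸ d))) ⟩
  oneS n + c * ∑ n (geomTerm c d (n ∸ d))       ≡⟨ cong (λ s → oneS n + c * s)
                                                     (geom-as-∑ c d n (n ∸ d) 1≤d (ℕP.∸-monoʳ-< 1≤d d≤n)) ⟨
  oneS n + c * geom c d (n ∸ d)                 ∎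
  where open ≡-Reasoning

geom-inverse : ∀ c d → 1 ≤ d → (oneS ⊖ mono c d) ⊛ geom c d ≈ oneS
geom-inverse c d 1≤d = begin
  (oneS ⊖ mono c d) ⊛ geom c d              ≈⟨ ⊛-distribʳ-⊖ oneS (mono c d) (geom c d) ⟩
  (oneS ⊛ geom c d) ⊖ (mono c d ⊛ geom c d) ≈⟨ coeffwise (λ n → cong (_- (mono c d ⊛ geom c d) n)
                                                 (coeff (⊛-identityˡ (geom c d)) n)) ⟩
  geom c d ⊖ (mono c d ⊛ geom c d)          ≈⟨ coeffwise (λ n → coeff-at n (d ℕP.≤? n)) ⟩
  oneS                                      ∎
  where
  open ≈-Reasoning
  cancel : ∀ (x y : ℤ) → (x + y) ℤ.- y ≡ x
  cancel = solve-∀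
  coeff-at : ∀ n → Dec (d ≤ n) → geom c d n ℤ.- (mono c d ⊛ geom c d) n ≡ oneS n
  coeff-at n (yes d≤n) = trans (cong₂ _-_ (geom-step c d n 1≤d d≤n) (mono-⊛-coeff c d (geom c d) n d≤n))
                               (cancel (oneS n) _)
  coeff-at n (no d≰n) = trans (cong₂ _-_ (geom-below c d n 1≤d (ℕP.≰⇒> d≰n))
                                          (mono-⊛-coeff-< c d (geom c d) n (ℕP.≰⇒> d≰n)))
                              (ℤP.+-identityʳ (oneS n))

⊕-mono-as-⊖ : ∀ f c e → f ⊕ mono c e ≈ f ⊖ mono (- c) e
⊕-mono-as-⊖ f c e = coeffwise λ n → coeff-at n (e ≡ᵇ n)
  where
  coeff-at : ∀ n b → f n + (if b then c else + 0) ≡ f n - (if b then - c else + 0)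
  coeff-at n true = cong (_+_ (f n)) (sym (ℤP.neg-involutive c))
  coeff-at n false = refl

geom-neg-inverse : ∀ d → 1 ≤ d → (oneS ⊕ mono (+ 1) d) ⊛ geom (- + 1) d ≈ oneS
geom-neg-inverse d 1≤d = ≈-trans (⊛-congˡ (geom (- + 1) d) (⊕-mono-as-⊖ oneS (+ 1) d)) (geom-inverse (- + 1) d 1≤d)

-- Products

prodS-++ : ∀ fs gs → prodS (fs ++ gs) ≈ prodS fs ⊛ prodS gs
prodS-++ [] gs = ≈-sym (⊛-identityˡ (prodS gs))
prodS-++ (f ∷ fs) gs = ≈-trans (⊛-congʳ f (prodS-++ fs gs)) (≈-sym (⊛-assoc f (prodS fs) (prodS gs)))

prodS-↭ : ∀ {fs gs} → fs ↭ gs → prodS fs ≈ prodS gs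
prodS-↭ ↭.refl = ≈-refl
prodS-↭ (↭.prep f p) = ⊛-congʳ f (prodS-↭ p)
prodS-↭ (↭.swap {xs = fs} {ys = gs} f g p) = begin
  f ⊛ (g ⊛ prodS fs) ≈⟨ ⊛-assoc f g (prodS fs) ⟨
  (f ⊛ g) ⊛ prodS fs ≈⟨ ⊛-cong (⊛-comm f g) (prodS-↭ p) ⟩
  (g ⊛ f) ⊛ prodS gs ≈⟨ ⊛-assoc g f (prodS gs) ⟩
  g ⊛ (f ⊛ prodS gs) ∎
  where open ≈-Reasoning
prodS-↭ (↭.trans p q) = ≈-trans (prodS-↭ p) (prodS-↭ q)

prodS-map-cong : ∀ {A : Set} (xs : List A) {f g : A → FPS} → (∀ x → x ∈ xs → f x ≈ g x) →
                 prodS (map f xs) ≈ prodS (map g xs)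
prodS-map-cong [] f≈g = ≈-refl
prodS-map-cong (x ∷ xs) f≈g = ⊛-cong (f≈g x (here refl)) (prodS-map-cong xs (λ y y∈ → f≈g y (there y∈)))

prodS-map-⊛ : ∀ {A : Set} (xs : List A) (f g : A → FPS) →
              prodS (map (λ x → f x ⊛ g x) xs) ≈ prodS (map f xs) ⊛ prodS (map g xs)
prodS-map-⊛ [] f g = ≈-sym (⊛-identityˡ oneS)
prodS-map-⊛ (x ∷ xs) f g = ≈-trans (⊛-congʳ (f x ⊛ g x) (prodS-map-⊛ xs f g))
                                   (⊛-interchange (f x) (g x) (prodS (map f xs)) (prodS (map g xs)))

prodS-map-filter : ∀ {A : Set} {P : A → Set} (P? : Decidable P) (f : A → FPS) xs →
                   (∀ x → x ∈ xs → ¬ P x → f x ≈ oneS) →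
                   prodS (map f xs) ≈ prodS (map f (filter P? xs))
prodS-map-filter P? f [] _ = ≈-refl
prodS-map-filter P? f (x ∷ xs) trivial with P? x
... | yes _ = ⊛-congʳ (f x) (prodS-map-filter P? f xs (λ y y∈ → trivial y (there y∈)))
... | no ¬Px = ≈-trans (⊛-cong (trivial x (here refl) ¬Px) (prodS-map-filter P? f xs (λ y y∈ → trivial y (there y∈))))
                       (⊛-identityˡ _)

prodS-map-mono : ∀ {A : Set} (e : A → ℕ) xs → prodS (map (λ x → mono (+ 1) (e x)) xs) ≈ mono (+ 1) (sum (map e xs))
prodS-map-mono e [] = oneS≈mono0
prodS-map-mono e (x ∷ xs) = ≈-trans (⊛-congʳ (mono (+ 1) (e x)) (prodS-map-mono e xs))
                                    (mono-⊛-mono (e x) (sum (map e xs)))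

OneBelow : ℕ → FPS → Set
OneBelow d h = ∀ i → i < d → h i ≡ oneS i

⊛-oneBelow : ∀ f {h d} n → OneBelow d h → n < d → (f ⊛ h) n ≡ f n
⊛-oneBelow f {h} n h≡1 n<d = begin
  (f ⊛ h) n                          ≡⟨ ⊛-coeff f h n ⟩
  ∑ (suc n) (λ i → f i * h (n ∸ i))  ≡⟨ ∑-single (suc n) n _ ℕP.≤-refl off-diagonal ⟩
  f n * h (n ∸ n)                    ≡⟨ cong (λ i → f n * h i) (ℕP.n∸n≡0 n) ⟩
  f n * h 0                          ≡⟨ cong (f n *_) (h≡1 0 (ℕP.≤-<-trans z≤n n<d)) ⟩
  f n * + 1                          ≡⟨ ℤP.*-identityʳ (f n) ⟩
  f n                                ∎
  where
  open ≡-Reasoning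
  off-diagonal : ∀ i → i < suc n → i ≢ n → f i * h (n ∸ i) ≡ + 0
  off-diagonal i i≤n i≢n with n ∸ i in eq
  ... | zero = contradiction (ℕP.≤-antisym (ℕP.≤-pred i≤n) (ℕP.m∸n≡0⇒m≤n eq)) i≢n
  ... | suc l = trans (cong (f i *_) (h≡1 (suc l) (ℕP.≤-<-trans (subst (_≤ n) eq (ℕP.m∸n≤m n i)) n<d)))
                      (ℤP.*-zeroʳ (f i))

prodS-upTo-stable : ∀ (G : ℕ → FPS) → (∀ i → OneBelow (suc i) (G i)) →
                    ∀ N n → n ≤ N → prodS (map G (upTo N)) n ≡ prodS (map G (upTo n)) n
prodS-upTo-stable G G≡1 N n n≤N with ℕP.m≤n⇒m<n∨m≡n n≤N
... | inj₂ refl = refl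
prodS-upTo-stable G G≡1 (suc N) n _ | inj₁ (s≤s n≤N) = begin
  prodS (map G (upTo (suc N))) n              ≡⟨ cong (λ gs → prodS (map G gs) n) (sym (LP.upTo-∷ʳ N)) ⟩
  prodS (map G (upTo N ++ N ∷ [])) n          ≡⟨ cong (λ gs → prodS gs n) (LP.map-++ G (upTo N) (N ∷ [])) ⟩
  prodS (map G (upTo N) ++ G N ∷ []) n        ≡⟨ coeff (prodS-++ (map G (upTo N)) (G N ∷ [])) n ⟩
  (prodS (map G (upTo N)) ⊛ (G N ⊛ oneS)) n   ≡⟨ coeff (⊛-congʳ (prodS (map G (upTo N))) (⊛-identityʳ (G N))) n ⟩
  (prodS (map G (upTo N)) ⊛ G N) n            ≡⟨ ⊛-oneBelow (prodS (map G (upTo N))) n (G≡1 N) (s≤s n≤N) ⟩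
  prodS (map G (upTo N)) n                    ≡⟨ prodS-upTo-stable G G≡1 N n n≤N ⟩
  prodS (map G (upTo n)) n                    ∎
  where open ≡-Reasoning

infProd-upTo : ∀ (F : ℕ → FPS) → (∀ i → OneBelow (suc i) (F (suc i))) →
               ∀ N n → n ≤ N → infProd F n ≡ prodS (map (F ∘ suc) (upTo N)) n
infProd-upTo F F≡1 N n n≤N = sym (prodS-upTo-stable (F ∘ suc) F≡1 N n n≤N)

-- Overpartitions as sequences of blocks

hasOverlined : ℕ → List Part → Bool
hasOverlined t [] = false
hasOverlined t ((s , true) ∷ π) = (s ≡ᵇ t) ∨ hasOverlined t π
hasOverlined t ((s , false) ∷ π) = hasOverlined t π

∈⇒hasOverlined : ∀ t π → (t , true) ∈ π → hasOverlined t π ≡ true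
∈⇒hasOverlined t ((s , true) ∷ π) (here refl) rewrite ≡ᵇ-true (refl {x = t}) = refl
∈⇒hasOverlined t ((s , true) ∷ π) (there t∈π) rewrite ∈⇒hasOverlined t π t∈π = BoolP.∨-zeroʳ (s ≡ᵇ t)
∈⇒hasOverlined t ((s , false) ∷ π) (there t∈π) = ∈⇒hasOverlined t π t∈π

hasOverlined⇒∈ : ∀ t π → hasOverlined t π ≡ true → (t , true) ∈ π
hasOverlined⇒∈ t ((s , true) ∷ π) has with s ℕ.≟ t
... | yes refl = here refl
... | no s≢t rewrite ≡ᵇ-false s≢t = there (hasOverlined⇒∈ t π has)
hasOverlined⇒∈ t ((s , false) ∷ π) has = there (hasOverlined⇒∈ t π has)

∉⇒hasOverlined : ∀ t π → (t , true) ∉ π → hasOverlined t π ≡ false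
∉⇒hasOverlined t π t∉π with hasOverlined t π in eq
... | false = refl
... | true = contradiction (hasOverlined⇒∈ t π eq) t∉π

hasOverlined⇒∉ : ∀ t π → hasOverlined t π ≡ false → (t , true) ∉ π
hasOverlined⇒∉ t π has t∈π with () ← trans (sym (∈⇒hasOverlined t π t∈π)) has

-- The parts of size t of an overpartition: t̄ if the flag is set, and then c copies of t.
Block : Set
Block = Bool × ℕ

block : ℕ → Block → List Part
block t (false , c) = replicate c (t , false)
block t (true , c) = (t , true) ∷ replicate c (t , false)

unbarred barred : ℕ → Block
unbarred c = false , c
barred c = true , c

blockWeight : ℕ → Block → ℕ
blockWeight t (false , c) = t ℕ.* c
blockWeight t (true , c) = t ℕ.* suc c

blockOf : ℕ → List Part → Block
blockOf t π = hasOverlined t π , countNon t π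

AllBelow : ℕ → List Part → Set
AllBelow S = All (λ p → size p < S)

blockOf-absent : ∀ t ρ → All (λ p → size p ≢ t) ρ → blockOf t ρ ≡ (false , 0)
blockOf-absent t [] [] = refl
blockOf-absent t ((s , true) ∷ ρ) (s≢t ∷ ρ≢t) rewrite ≡ᵇ-false s≢t = blockOf-absent t ρ ρ≢t
blockOf-absent t ((s , false) ∷ ρ) (s≢t ∷ ρ≢t) rewrite ≡ᵇ-false s≢t = blockOf-absent t ρ ρ≢t

blockOf-replicate-same : ∀ S c ρ → blockOf S (replicate c (S , false) ++ ρ) ≡ (hasOverlined S ρ , c ℕ.+ countNon S ρ)
blockOf-replicate-same S zero ρ = refl
blockOf-replicate-same S (suc c) ρ rewrite ≡ᵇ-true (refl {x = S}) =
  cong (λ (b , n) → b , suc n) (blockOf-replicate-same S c ρ)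

blockOf-replicate-other : ∀ S c t ρ → S ≢ t → blockOf t (replicate c (S , false) ++ ρ) ≡ blockOf t ρ
blockOf-replicate-other S zero t ρ S≢t = refl
blockOf-replicate-other S (suc c) t ρ S≢t rewrite ≡ᵇ-false S≢t = blockOf-replicate-other S c t ρ S≢t

blockOf-block-same : ∀ S ch ρ → AllBelow S ρ → blockOf S (block S ch ++ ρ) ≡ ch
blockOf-block-same S (false , c) ρ ρ<S = begin
  blockOf S (replicate c (S , false) ++ ρ)  ≡⟨ blockOf-replicate-same S c ρ ⟩
  (hasOverlined S ρ , c ℕ.+ countNon S ρ)   ≡⟨ cong (λ (b , n) → b , c ℕ.+ n) (blockOf-absent S ρ (All.map ℕP.<⇒≢ ρ<S)) ⟩
  (false , c ℕ.+ 0)                         ≡⟨ cong (false ,_) (ℕP.+-identityʳ c) ⟩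
  (false , c)                               ∎
  where open ≡-Reasoning
blockOf-block-same S (true , c) ρ ρ<S rewrite ≡ᵇ-true (refl {x = S}) =
  cong (true ,_) (cong proj₂ (blockOf-block-same S (false , c) ρ ρ<S))

blockOf-block-other : ∀ S ch t ρ → S ≢ t → blockOf t (block S ch ++ ρ) ≡ blockOf t ρ
blockOf-block-other S (false , c) t ρ S≢t = blockOf-replicate-other S c t ρ S≢t
blockOf-block-other S (true , c) t ρ S≢t rewrite ≡ᵇ-false S≢t = blockOf-replicate-other S c t ρ S≢t

weight-++ : ∀ π ρ → weight (π ++ ρ) ≡ weight π ℕ.+ weight ρ
weight-++ [] ρ = refl
weight-++ ((t , _) ∷ π) ρ = trans (cong (t ℕ.+_) (weight-++ π ρ)) (sym (ℕP.+-assoc t (weight π) (weight ρ)))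

weight-replicate : ∀ t c → weight (replicate c (t , false)) ≡ t ℕ.* c
weight-replicate t zero = sym (ℕP.*-zeroʳ t)
weight-replicate t (suc c) = trans (cong (t ℕ.+_) (weight-replicate t c)) (sym (ℕP.*-suc t c))

weight-block : ∀ t ch → weight (block t ch) ≡ blockWeight t ch
weight-block t (false , c) = weight-replicate t c
weight-block t (true , c) = trans (cong (t ℕ.+_) (weight-replicate t c)) (sym (ℕP.*-suc t c))

parts-≤-weight : ∀ π → All (λ p → size p ≤ weight π) π
parts-≤-weight [] = []
parts-≤-weight ((t , _) ∷ π) =
  ℕP.m≤m+n t (weight π) ∷ All.map (λ p≤wπ → ℕP.≤-trans p≤wπ (ℕP.m≤n+m (weight π) t)) (parts-≤-weight π)

step-≤ : ∀ p q → Step p q → size q ≤ size p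
step-≤ _ _ (inj₁ t′<t) = ℕP.<⇒≤ t′<t
step-≤ _ _ (inj₂ (refl , _)) = ℕP.≤-refl

parts-≤-head : ∀ p π → Linked Step (p ∷ π) → All (λ q → size q ≤ size p) π
parts-≤-head p [] _ = []
parts-≤-head p (q ∷ π) (p→q ∷ linked) =
  Linked⇒All {R = λ p q → size q ≤ size p} (λ q≤p r≤q → ℕP.≤-trans r≤q q≤p) {v = p}
             (step-≤ p q p→q) (Linked.map (λ {x} {y} → step-≤ x y) linked)

step-into-replicate : ∀ S b c ρ → AllBelow S ρ →
                      Connected Step (just (S , b)) (head (replicate c (S , false) ++ ρ))
step-into-replicate S b (suc c) ρ _ = Connected.just (inj₂ (refl , refl))
step-into-replicate S b zero [] [] = Connected.just-nothing
step-into-replicate S b zero (r ∷ ρ) (r<S ∷ _) = Connected.just (inj₁ r<S)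

linked-replicate : ∀ S c ρ → AllBelow S ρ → Linked Step ρ → Linked Step (replicate c (S , false) ++ ρ)
linked-replicate S zero ρ _ linked = linked
linked-replicate S (suc c) ρ ρ<S linked =
  step-into-replicate S false c ρ ρ<S Linked.∷′ linked-replicate S c ρ ρ<S linked

All-replicate : ∀ {P : Part → Set} S c ρ → P (S , false) → All P ρ → All P (replicate c (S , false) ++ ρ)
All-replicate S zero ρ _ Pρ = Pρ
All-replicate S (suc c) ρ PS Pρ = PS ∷ All-replicate S c ρ PS Pρ

All-block : ∀ {P : Part → Set} S ch ρ → P (S , false) → P (S , true) → All P ρ → All P (block S ch ++ ρ)
All-block S (false , c) ρ PS _ Pρ = All-replicate S c ρ PS Pρ
All-block S (true , c) ρ PS PS̄ Pρ = PS̄ ∷ All-replicate S c ρ PS Pρ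

IsOverpartition-block : ∀ S ch ρ → 1 ≤ S → AllBelow S ρ → IsOverpartition ρ → IsOverpartition (block S ch ++ ρ)
IsOverpartition-block S ch ρ 1≤S ρ<S (positive , linked) = All-block S ch ρ 1≤S 1≤S positive , linked-block ch
  where
  linked-block : ∀ ch → Linked Step (block S ch ++ ρ)
  linked-block (false , c) = linked-replicate S c ρ ρ<S linked
  linked-block (true , c) = step-into-replicate S true c ρ ρ<S Linked.∷′ linked-replicate S c ρ ρ<S linked

decompose : ∀ S π → IsOverpartition π → All (λ p → size p ≤ S) π →
            ∃[ ch ] ∃[ ρ ] (π ≡ block S ch ++ ρ × AllBelow S ρ × IsOverpartition ρ)
decompose S [] op _ = (false , 0) , [] , refl , [] , op
decompose S ((t , b) ∷ π) (pos , linked) (t≤S ∷ π≤S) with ℕP.m≤n⇒m<n∨m≡n t≤S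
... | inj₁ t<S = (false , 0) , (t , b) ∷ π , refl ,
                 t<S ∷ All.map (λ q≤t → ℕP.≤-<-trans q≤t t<S) (parts-≤-head (t , b) π linked) , (pos , linked)
... | inj₂ refl with decompose t π (All.tail pos , Linked.tail linked) π≤S | b
...   | (false , c) , ρ , refl , ρ<t , opρ | false = (false , suc c) , ρ , refl , ρ<t , opρ
...   | (false , c) , ρ , refl , ρ<t , opρ | true = (true , c) , ρ , refl , ρ<t , opρ
decompose S ((t , b) ∷ π) (pos , inj₁ t<t ∷ _) (t≤S ∷ π≤S) | inj₂ refl | (true , c) , ρ , refl , _ , _ | _ =
  contradiction t<t (ℕP.<-irrefl refl)

-- Enumeration size by size

module _ {A B : Set} where

  +-length-concatMap : ∀ (f : A → List B) xs → + length (concatMap f xs) ≡ sumℤ (map (λ x → + length (f x)) xs)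
  +-length-concatMap f [] = refl
  +-length-concatMap f (x ∷ xs) = begin
    + length (f x ++ concatMap f xs)                  ≡⟨ cong +_ (LP.length-++ (f x)) ⟩
    + (length (f x) ℕ.+ length (concatMap f xs))      ≡⟨ ℤP.pos-+ (length (f x)) _ ⟩
    + length (f x) + + length (concatMap f xs)        ≡⟨ cong (_+_ (+ length (f x))) (+-length-concatMap f xs) ⟩
    + length (f x) + sumℤ (map (λ y → + length (f y)) xs) ∎
    where open ≡-Reasoning

  length-concatMap-map : ∀ {C : Set} (g : A → B → C) xs ys →
                         length (concatMap (λ x → map (g x) ys) xs) ≡ length xs ℕ.* length ys
  length-concatMap-map g [] ys = refl
  length-concatMap-map g (x ∷ xs) ys =
    trans (LP.length-++ (map (g x) ys)) (cong₂ ℕ._+_ (LP.length-map (g x) ys) (length-concatMap-map g xs ys))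

  ∈-concatMap⁺′ : ∀ (f : A → List B) {xs x y} → x ∈ xs → y ∈ f x → y ∈ concatMap f xs
  ∈-concatMap⁺′ f x∈xs y∈fx = ∈-concatMap⁺ f (lose x∈xs y∈fx)

  -- The lists f x are disjoint because every element remembers, through label, the x it came from.
  Unique-concatMap : ∀ (f : A → List B) (label : B → A) {xs} → Unique xs →
                     (∀ x → x ∈ xs → Unique (f x)) →
                     (∀ x y → x ∈ xs → y ∈ f x → label y ≡ x) →
                     Unique (concatMap f xs)
  Unique-concatMap f label {[]} _ _ _ = []
  Unique-concatMap f label {x ∷ xs} (x∉xs ∷ unique-xs) unique-f labelled =
    Unique.++⁺ (unique-f x (here refl))
               (Unique-concatMap f label unique-xs (λ x′ x′∈ → unique-f x′ (there x′∈))
                                 (λ x′ y x′∈ → labelled x′ y (there x′∈)))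
               disjoint
    where
    disjoint : ∀ {y} → ¬ (y ∈ f x × y ∈ concatMap f xs)
    disjoint (y∈fx , y∈rest) with find (∈-concatMap⁻ f y∈rest)
    ... | x′ , x′∈xs , y∈fx′ =
      All.lookup x∉xs x′∈xs (trans (sym (labelled x _ (here refl) y∈fx)) (labelled x′ _ (there x′∈xs) y∈fx′))

sizes : ℕ → List ℕ
sizes N = map suc (downFrom N)

∈-sizes⁺ : ∀ {N S} → 1 ≤ S → S ≤ N → S ∈ sizes N
∈-sizes⁺ {S = suc s} _ S≤N = ∈-map⁺ suc (∈-downFrom⁺ S≤N)

∈-sizes⁻ : ∀ {N S} → S ∈ sizes N → 1 ≤ S
∈-sizes⁻ S∈ with _ , _ , refl ← ∈-map⁻ suc S∈ = s≤s z≤n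

Unique-sizes : ∀ N → Unique (sizes N)
Unique-sizes N = Unique.map⁺ ℕP.suc-injective (Unique.downFrom⁺ N)

module Enumeration
  (Allowed : ℕ → Block → Set)
  (blocks : ℕ → ℕ → List Block)
  (blocks-sound : ∀ S i ch → 1 ≤ S → ch ∈ blocks S i → Allowed S ch × blockWeight S ch ≡ i)
  (blocks-complete : ∀ S ch → 1 ≤ S → Allowed S ch → ch ∈ blocks S (blockWeight S ch))
  (blocks-unique : ∀ S i → Unique (blocks S i))
  where

  Admissible : ℕ → ℕ → List Part → Set
  Admissible M n π = IsOverpartition π × All (λ p → size p ≤ M) π × weight π ≡ n ×
                     (∀ t → 1 ≤ t → t ≤ M → Allowed t (blockOf t π))

  enumerate : ℕ → ℕ → List (List Part)
  enumerate zero zero = [] ∷ []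
  enumerate zero (suc n) = []
  enumerate (suc M) n =
    concatMap (λ j → concatMap (λ ch → map (block (suc M) ch ++_) (enumerate M (n ∸ j))) (blocks (suc M) j))
              (upTo (suc n))

  enumerate-sound : ∀ M n π → π ∈ enumerate M n → Admissible M n π
  enumerate-sound zero zero .[] (here refl) = ([] , []) , [] , refl , λ t 1≤t t≤0 → contradiction (ℕP.≤-trans 1≤t t≤0) λ ()
  enumerate-sound (suc M) n π π∈
    with j , j∈ , π∈ ← find (∈-concatMap⁻ _ π∈)
    with ch , ch∈ , π∈ ← find (∈-concatMap⁻ _ π∈)
    with ρ , ρ∈ , refl ← ∈-map⁻ (block (suc M) ch ++_) π∈
    with opρ , ρ≤M , wρ , allowedρ ← enumerate-sound M (n ∸ j) ρ ρ∈ =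
    IsOverpartition-block S ch ρ (s≤s z≤n) ρ<S opρ ,
    All-block S ch ρ ℕP.≤-refl ℕP.≤-refl (All.map ℕP.m≤n⇒m≤1+n ρ≤M) ,
    weight-sum ,
    allowed
    where
    S = suc M
    ρ<S : AllBelow S ρ
    ρ<S = All.map s≤s ρ≤M
    allowedS = blocks-sound S j ch (s≤s z≤n) ch∈
    weight-sum : weight (block S ch ++ ρ) ≡ n
    weight-sum = begin
      weight (block S ch ++ ρ)            ≡⟨ weight-++ (block S ch) ρ ⟩
      weight (block S ch) ℕ.+ weight ρ    ≡⟨ cong₂ ℕ._+_ (trans (weight-block S ch) (proj₂ allowedS)) wρ ⟩
      j ℕ.+ (n ∸ j)                       ≡⟨ ℕP.m+[n∸m]≡n (ℕP.≤-pred (∈-upTo⁻ j∈)) ⟩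
      n                                   ∎
      where open ≡-Reasoning
    allowed : ∀ t → 1 ≤ t → t ≤ S → Allowed t (blockOf t (block S ch ++ ρ))
    allowed t 1≤t t≤S with ℕP.m≤n⇒m<n∨m≡n t≤S
    ... | inj₂ refl = subst (Allowed t) (sym (blockOf-block-same S ch ρ ρ<S)) (proj₁ allowedS)
    ... | inj₁ t<S = subst (Allowed t) (sym (blockOf-block-other S ch t ρ (ℕP.>⇒≢ t<S)))
                           (allowedρ t 1≤t (ℕP.≤-pred t<S))

  enumerate-complete : ∀ M n π → Admissible M n π → π ∈ enumerate M n
  enumerate-complete zero n [] (_ , _ , refl , _) = here refl
  enumerate-complete zero n ((t , _) ∷ π) ((1≤t ∷ _ , _) , t≤0 ∷ _ , _) = contradiction (ℕP.≤-trans 1≤t t≤0) λ ()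
  enumerate-complete (suc M) n π (op , π≤S , wπ , allowed)
    with ch , ρ , refl , ρ<S , opρ ← decompose (suc M) π op π≤S =
    ∈-concatMap⁺′ _ (∈-upTo⁺ (s≤s j≤n)) (∈-concatMap⁺′ _ ch∈ (∈-map⁺ (block S ch ++_) ρ∈))
    where
    S = suc M
    j = blockWeight S ch
    ch∈ : ch ∈ blocks S j
    ch∈ = blocks-complete S ch (s≤s z≤n)
            (subst (Allowed S) (blockOf-block-same S ch ρ ρ<S) (allowed S (s≤s z≤n) ℕP.≤-refl))
    j+wρ≡n : j ℕ.+ weight ρ ≡ n
    j+wρ≡n = trans (cong (ℕ._+ weight ρ) (sym (weight-block S ch))) (trans (sym (weight-++ (block S ch) ρ)) wπ)
    j≤n : j ≤ n
    j≤n = subst (j ≤_) j+wρ≡n (ℕP.m≤m+n j (weight ρ))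
    ρ∈ : ρ ∈ enumerate M (n ∸ j)
    ρ∈ = enumerate-complete M (n ∸ j) ρ
           (opρ , All.map ℕP.≤-pred ρ<S , trans (sym (ℕP.m+n∸m≡n j (weight ρ))) (cong (_∸ j) j+wρ≡n) ,
            λ t 1≤t t≤M → subst (Allowed t) (blockOf-block-other S ch t ρ (ℕP.>⇒≢ (s≤s t≤M)))
                                 (allowed t 1≤t (ℕP.m≤n⇒m≤1+n t≤M)))

  enumerate-unique : ∀ M n → Unique (enumerate M n)
  enumerate-unique zero zero = [] ∷ []
  enumerate-unique zero (suc n) = []
  enumerate-unique (suc M) n =
    Unique-concatMap _ (λ π → blockWeight S (blockOf S π)) (Unique.upTo⁺ (suc n))
      (λ j _ → Unique-concatMap _ (blockOf S) (blocks-unique S j)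
                 (λ ch _ → Unique.map⁺ (LP.++-cancelˡ (block S ch) _ _) (enumerate-unique M (n ∸ j)))
                 (λ ch π _ π∈ → blockOf-extension j ch π π∈))
      (λ j π _ π∈ → weight-of-extension j π π∈)
    where
    S = suc M
    blockOf-extension : ∀ j ch π → π ∈ map (block S ch ++_) (enumerate M (n ∸ j)) → blockOf S π ≡ ch
    blockOf-extension j ch π π∈ with ρ , ρ∈ , refl ← ∈-map⁻ (block S ch ++_) π∈ =
      blockOf-block-same S ch ρ (All.map s≤s (proj₁ (proj₂ (enumerate-sound M (n ∸ j) ρ ρ∈))))
    weight-of-extension : ∀ j π → π ∈ concatMap (λ ch → map (block S ch ++_) (enumerate M (n ∸ j))) (blocks S j) →
                          blockWeight S (blockOf S π) ≡ j
    weight-of-extension j π π∈ with ch , ch∈ , π∈′ ← find (∈-concatMap⁻ _ π∈) =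
      trans (cong (blockWeight S) (blockOf-extension j ch π π∈′)) (proj₂ (blocks-sound S j ch (s≤s z≤n) ch∈))

  blockCount : ℕ → FPS
  blockCount S i = + length (blocks S i)

  enumerate-count : ∀ M n → + length (enumerate M n) ≡ prodS (map blockCount (sizes M)) n
  enumerate-count zero zero = refl
  enumerate-count zero (suc n) = refl
  enumerate-count (suc M) n = begin
    + length (enumerate (suc M) n)
      ≡⟨ +-length-concatMap extensions (upTo (suc n)) ⟩
    sumℤ (map (λ j → + length (extensions j)) (upTo (suc n)))
      ≡⟨ sumℤ-map-upTo (suc n) (λ j → + length (extensions j)) ⟩
    ∑ (suc n) (λ j → + length (extensions j))
      ≡⟨ ∑-cong (suc n) (λ j _ → count-extensions j) ⟩
    ∑ (suc n) (λ j → blockCount S j * prodS (map blockCount (sizes M)) (n ∸ j))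
      ≡⟨ ⊛-coeff (blockCount S) (prodS (map blockCount (sizes M))) n ⟨
    prodS (map blockCount (sizes (suc M))) n ∎
    where
    open ≡-Reasoning
    S = suc M
    extensions : ℕ → List (List Part)
    extensions j = concatMap (λ ch → map (block S ch ++_) (enumerate M (n ∸ j))) (blocks S j)
    count-extensions : ∀ j → + length (extensions j) ≡ blockCount S j * prodS (map blockCount (sizes M)) (n ∸ j)
    count-extensions j = begin
      + length (extensions j)                                  ≡⟨ cong +_ (length-concatMap-map (λ ch → block S ch ++_) (blocks S j) _) ⟩
      + (length (blocks S j) ℕ.* length (enumerate M (n ∸ j))) ≡⟨ ℤP.pos-* (length (blocks S j)) _ ⟩
      blockCount S j * + length (enumerate M (n ∸ j))          ≡⟨ cong (blockCount S j *_) (enumerate-count M (n ∸ j)) ⟩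
      blockCount S j * prodS (map blockCount (sizes M)) (n ∸ j) ∎

-- Blocks constrained by the mes condition

unique-↭ : ∀ {A : Set} {xs ys : List A} → Unique xs → Unique ys →
           (∀ {x} → x ∈ xs → x ∈ ys) → (∀ {x} → x ∈ ys → x ∈ xs) → xs ↭ ys
unique-↭ unique-xs unique-ys xs⊆ys ys⊆xs = ∼bag⇒↭ (unique∧set⇒bag unique-xs unique-ys (mk⇔ xs⊆ys ys⊆xs))

+-length-filter : ∀ {A : Set} {P : A → Set} (P? : Decidable P) xs →
                  + length (filter P? xs) ≡ sumℤ (map (λ x → if does (P? x) then + 1 else + 0) xs)
+-length-filter P? [] = refl
+-length-filter P? (x ∷ xs) with does (P? x)
... | true = trans (ℤP.pos-+ 1 _) (cong (_+_ (+ 1)) (+-length-filter P? xs))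
... | false = trans (+-length-filter P? xs) (sym (ℤP.+-identityˡ _))

cofactors : ℕ → ℕ → List ℕ
cofactors S i = filter (λ c → S ℕ.* c ℕ.≟ i) (upTo (suc i))

∈-cofactors⁺ : ∀ S {i c} → 1 ≤ S → S ℕ.* c ≡ i → c ∈ cofactors S i
∈-cofactors⁺ S {c = c} 1≤S refl =
  ∈-filter⁺ (λ c′ → S ℕ.* c′ ℕ.≟ S ℕ.* c) (∈-upTo⁺ (s≤s (ℕP.m≤n*m c S ⦃ ℕ.>-nonZero 1≤S ⦄))) refl

∈-cofactors⁻ : ∀ S i {c} → c ∈ cofactors S i → S ℕ.* c ≡ i
∈-cofactors⁻ S i c∈ = proj₂ (∈-filter⁻ (λ c′ → S ℕ.* c′ ℕ.≟ i) {xs = upTo (suc i)} c∈)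

Unique-cofactors : ∀ S i → Unique (cofactors S i)
Unique-cofactors S i = Unique.filter⁺ (λ c → S ℕ.* c ℕ.≟ i) (Unique.upTo⁺ (suc i))

length-cofactors : ∀ S i → + length (cofactors S i) ≡ geom (+ 1) S i
length-cofactors S i = trans (+-length-filter (λ c → S ℕ.* c ℕ.≟ i) (upTo (suc i)))
  (cong sumℤ (LP.map-cong (λ j → cong (λ x → if S ℕ.* j ≡ᵇ i then x else + 0) (sym (ℤP.^-zeroˡ j))) (upTo (suc i))))

cofactorsAbove : ℕ → ℕ → ℕ → List ℕ
cofactorsAbove k S i with k ℕ.* S ℕP.≤? i
... | yes _ = cofactors S (i ∸ k ℕ.* S)
... | no _ = []

*-+-split : ∀ S k c → S ℕ.* (k ℕ.+ c) ≡ k ℕ.* S ℕ.+ S ℕ.* c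
*-+-split S k c = trans (ℕP.*-distribˡ-+ S k c) (cong (ℕ._+ S ℕ.* c) (ℕP.*-comm S k))

∈-cofactorsAbove⁺ : ∀ k S {i c} → 1 ≤ S → S ℕ.* (k ℕ.+ c) ≡ i → c ∈ cofactorsAbove k S i
∈-cofactorsAbove⁺ k S {i} {c} 1≤S refl with k ℕ.* S ℕP.≤? S ℕ.* (k ℕ.+ c)
... | yes _ = ∈-cofactors⁺ S 1≤S (sym (trans (cong (_∸ k ℕ.* S) (*-+-split S k c)) (ℕP.m+n∸m≡n (k ℕ.* S) _)))
... | no kS≰ = contradiction (subst (k ℕ.* S ≤_) (sym (*-+-split S k c)) (ℕP.m≤m+n (k ℕ.* S) (S ℕ.* c))) kS≰

∈-cofactorsAbove⁻ : ∀ k S i {c} → c ∈ cofactorsAbove k S i → S ℕ.* (k ℕ.+ c) ≡ i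
∈-cofactorsAbove⁻ k S i {c} c∈ with k ℕ.* S ℕP.≤? i
... | yes kS≤i = trans (*-+-split S k c)
                      (trans (cong (k ℕ.* S ℕ.+_) (∈-cofactors⁻ S (i ∸ k ℕ.* S) c∈)) (ℕP.m+[n∸m]≡n kS≤i))

Unique-cofactorsAbove : ∀ k S i → Unique (cofactorsAbove k S i)
Unique-cofactorsAbove k S i with k ℕ.* S ℕP.≤? i
... | yes _ = Unique-cofactors S _
... | no _ = []

length-cofactorsAbove : ∀ k S i → + length (cofactorsAbove k S i) ≡ (mono (+ 1) (k ℕ.* S) ⊛ geom (+ 1) S) i
length-cofactorsAbove k S i with k ℕ.* S ℕP.≤? i
... | yes kS≤i = trans (length-cofactors S (i ∸ k ℕ.* S))
                       (trans (sym (ℤP.*-identityˡ _)) (sym (mono-⊛-coeff (+ 1) (k ℕ.* S) (geom (+ 1) S) i kS≤i)))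
... | no kS≰i = sym (mono-⊛-coeff-< (+ 1) (k ℕ.* S) (geom (+ 1) S) i (ℕP.≰⇒> kS≰i))

-- Relative to m = mes(π): the size m itself, the smaller sizes ≡ a (mod A), and all others.
data SizeClass : Set where
  mesSize belowMes other : SizeClass

module Blocks (R : ℕ) where

  AllowedIn : SizeClass → Block → Set
  AllowedIn mesSize (b , c) = b ≡ false × c < R
  AllowedIn belowMes (b , c) = b ≡ false × R ≤ c
  AllowedIn other _ = ⊤

  blocksIn : SizeClass → ℕ → ℕ → List Block
  blocksIn mesSize S i = map unbarred (filter (_<? R) (cofactors S i))
  blocksIn belowMes S i = map (unbarred ∘ (R ℕ.+_)) (cofactorsAbove R S i)
  blocksIn other S i = map unbarred (cofactors S i) ++ map barred (cofactorsAbove 1 S i)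

  blocksIn-sound : ∀ cl S i ch → 1 ≤ S → ch ∈ blocksIn cl S i → AllowedIn cl ch × blockWeight S ch ≡ i
  blocksIn-sound mesSize S i ch 1≤S ch∈ with c , c∈ , refl ← ∈-map⁻ unbarred ch∈
    with c∈cofactors , c<R ← ∈-filter⁻ (_<? R) {xs = cofactors S i} c∈ =
    (refl , c<R) , ∈-cofactors⁻ S i c∈cofactors
  blocksIn-sound belowMes S i ch 1≤S ch∈ with c , c∈ , refl ← ∈-map⁻ (unbarred ∘ (R ℕ.+_)) ch∈ =
    (refl , ℕP.m≤m+n R c) , ∈-cofactorsAbove⁻ R S i c∈
  blocksIn-sound other S i ch 1≤S ch∈ with ∈-++⁻ (map unbarred (cofactors S i)) ch∈
  ... | inj₁ ch∈plain with c , c∈ , refl ← ∈-map⁻ unbarred ch∈plain = tt , ∈-cofactors⁻ S i c∈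
  ... | inj₂ ch∈overlined with c , c∈ , refl ← ∈-map⁻ barred ch∈overlined = tt , ∈-cofactorsAbove⁻ 1 S i c∈

  blocksIn-complete : ∀ cl S ch → 1 ≤ S → AllowedIn cl ch → ch ∈ blocksIn cl S (blockWeight S ch)
  blocksIn-complete mesSize S (false , c) 1≤S (_ , c<R) =
    ∈-map⁺ unbarred (∈-filter⁺ (_<? R) (∈-cofactors⁺ S 1≤S refl) c<R)
  blocksIn-complete belowMes S (false , c) 1≤S (_ , R≤c) =
    subst (_∈ blocksIn belowMes S (S ℕ.* c)) (cong unbarred (ℕP.m+[n∸m]≡n R≤c))
      (∈-map⁺ (unbarred ∘ (R ℕ.+_)) (∈-cofactorsAbove⁺ R S 1≤S (cong (S ℕ.*_) (ℕP.m+[n∸m]≡n R≤c))))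
  blocksIn-complete other S (false , c) 1≤S _ = ∈-++⁺ˡ (∈-map⁺ unbarred (∈-cofactors⁺ S 1≤S refl))
  blocksIn-complete other S (true , c) 1≤S _ =
    ∈-++⁺ʳ (map unbarred (cofactors S (S ℕ.* suc c))) (∈-map⁺ barred (∈-cofactorsAbove⁺ 1 S 1≤S refl))

  blocksIn-unique : ∀ cl S i → Unique (blocksIn cl S i)
  blocksIn-unique mesSize S i = Unique.map⁺ (cong proj₂) (Unique.filter⁺ (_<? R) (Unique-cofactors S i))
  blocksIn-unique belowMes S i = Unique.map⁺ (ℕP.+-cancelˡ-≡ R _ _ ∘ cong proj₂) (Unique-cofactorsAbove R S i)
  blocksIn-unique other S i =
    Unique.++⁺ (Unique.map⁺ (cong proj₂) (Unique-cofactors S i)) (Unique.map⁺ (cong proj₂) (Unique-cofactorsAbove 1 S i))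
               λ (p , q) → plain≢overlined p q
    where
    plain≢overlined : ∀ {ch} → ch ∈ map unbarred (cofactors S i) → ch ∉ map barred (cofactorsAbove 1 S i)
    plain≢overlined p q with _ , _ , refl ← ∈-map⁻ unbarred p with _ , _ , () ← ∈-map⁻ barred q

  classFactor : SizeClass → ℕ → FPS
  classFactor mesSize S = oneS ⊖ mono (+ 1) (R ℕ.* S)
  classFactor belowMes S = mono (+ 1) (R ℕ.* S)
  classFactor other S = oneS ⊕ mono (+ 1) S

  cofactors-split : ∀ S i → 1 ≤ S →
    length (filter (_<? R) (cofactors S i)) ℕ.+ length (cofactorsAbove R S i) ≡ length (cofactors S i)
  cofactors-split S i 1≤S = begin
    length (filter (_<? R) (cofactors S i)) ℕ.+ length (cofactorsAbove R S i)
      ≡⟨ cong (length (filter (_<? R) (cofactors S i)) ℕ.+_) (LP.length-map (R ℕ.+_) (cofactorsAbove R S i)) ⟨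
    length (filter (_<? R) (cofactors S i)) ℕ.+ length (map (R ℕ.+_) (cofactorsAbove R S i))
      ≡⟨ LP.length-++ (filter (_<? R) (cofactors S i)) {map (R ℕ.+_) (cofactorsAbove R S i)} ⟨
    length (filter (_<? R) (cofactors S i) ++ map (R ℕ.+_) (cofactorsAbove R S i))
      ≡⟨ ↭-length (unique-↭ unique-split (Unique-cofactors S i) split⊆ ⊆split) ⟩
    length (cofactors S i) ∎
    where
    open ≡-Reasoning
    below-R : ∀ {c} → c ∈ filter (_<? R) (cofactors S i) → c < R
    below-R c∈ = proj₂ (∈-filter⁻ (_<? R) {xs = cofactors S i} c∈)
    unique-split : Unique (filter (_<? R) (cofactors S i) ++ map (R ℕ.+_) (cofactorsAbove R S i))
    unique-split = Unique.++⁺ (Unique.filter⁺ (_<? R) (Unique-cofactors S i))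
                              (Unique.map⁺ (ℕP.+-cancelˡ-≡ R _ _) (Unique-cofactorsAbove R S i))
                              λ (c∈below , c∈above) → let _ , _ , c≡R+c′ = ∈-map⁻ (R ℕ.+_) c∈above in
                                ℕP.<⇒≱ (below-R c∈below) (subst (R ≤_) (sym c≡R+c′) (ℕP.m≤m+n R _))
    split⊆ : ∀ {c} → c ∈ filter (_<? R) (cofactors S i) ++ map (R ℕ.+_) (cofactorsAbove R S i) → c ∈ cofactors S i
    split⊆ c∈ with ∈-++⁻ (filter (_<? R) (cofactors S i)) c∈
    ... | inj₁ c∈below = proj₁ (∈-filter⁻ (_<? R) {xs = cofactors S i} c∈below)
    ... | inj₂ c∈above with c′ , c′∈ , refl ← ∈-map⁻ (R ℕ.+_) c∈above =
      ∈-cofactors⁺ S 1≤S (∈-cofactorsAbove⁻ R S i c′∈)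
    ⊆split : ∀ {c} → c ∈ cofactors S i → c ∈ filter (_<? R) (cofactors S i) ++ map (R ℕ.+_) (cofactorsAbove R S i)
    ⊆split {c} c∈ with c <? R
    ... | yes c<R = ∈-++⁺ˡ (∈-filter⁺ (_<? R) c∈ c<R)
    ... | no c≮R = ∈-++⁺ʳ (filter (_<? R) (cofactors S i))
                     (subst (_∈ map (R ℕ.+_) (cofactorsAbove R S i)) (ℕP.m+[n∸m]≡n (ℕP.≮⇒≥ c≮R))
                       (∈-map⁺ (R ℕ.+_) (∈-cofactorsAbove⁺ R S 1≤S
                         (trans (cong (S ℕ.*_) (ℕP.m+[n∸m]≡n (ℕP.≮⇒≥ c≮R))) (∈-cofactors⁻ S i c∈)))))

  length-blocksIn : ∀ cl S i → 1 ≤ S → + length (blocksIn cl S i) ≡ (classFactor cl S ⊛ geom (+ 1) S) i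
  length-blocksIn mesSize S i 1≤S = begin
    + length (map unbarred (filter (_<? R) (cofactors S i)))
      ≡⟨ cong +_ (LP.length-map unbarred (filter (_<? R) (cofactors S i))) ⟩
    + length (filter (_<? R) (cofactors S i))
      ≡⟨ cancel (length (filter (_<? R) (cofactors S i))) (length (cofactorsAbove R S i)) ⟩
    + (length (filter (_<? R) (cofactors S i)) ℕ.+ length (cofactorsAbove R S i)) - + length (cofactorsAbove R S i)
      ≡⟨ cong₂ (λ x y → + x - y) (cofactors-split S i 1≤S) (length-cofactorsAbove R S i) ⟩
    + length (cofactors S i) - (mono (+ 1) (R ℕ.* S) ⊛ geom (+ 1) S) i
      ≡⟨ cong (_- (mono (+ 1) (R ℕ.* S) ⊛ geom (+ 1) S) i)
              (trans (length-cofactors S i) (sym (coeff (⊛-identityˡ (geom (+ 1) S)) i))) ⟩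
    (oneS ⊛ geom (+ 1) S) i - (mono (+ 1) (R ℕ.* S) ⊛ geom (+ 1) S) i
      ≡⟨ coeff (⊛-distribʳ-⊖ oneS (mono (+ 1) (R ℕ.* S)) (geom (+ 1) S)) i ⟨
    (classFactor mesSize S ⊛ geom (+ 1) S) i ∎
    where
    open ≡-Reasoning
    cancel : ∀ x y → + x ≡ + (x ℕ.+ y) - + y
    cancel x y = trans (sym (ℤP.+-identityʳ (+ x))) (trans (cong (_+_ (+ x)) (sym (ℤP.+-inverseʳ (+ y))))
                   (trans (sym (ℤP.+-assoc (+ x) (+ y) (- + y))) (cong (_- + y) (sym (ℤP.pos-+ x y)))))
  length-blocksIn belowMes S i _ =
    trans (cong +_ (LP.length-map (unbarred ∘ (R ℕ.+_)) (cofactorsAbove R S i))) (length-cofactorsAbove R S i)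
  length-blocksIn other S i _ = begin
    + length (map unbarred (cofactors S i) ++ map barred (cofactorsAbove 1 S i))
      ≡⟨ cong +_ (LP.length-++ (map unbarred (cofactors S i)) {map barred (cofactorsAbove 1 S i)}) ⟩
    + (length (map unbarred (cofactors S i)) ℕ.+ length (map barred (cofactorsAbove 1 S i)))
      ≡⟨ ℤP.pos-+ (length (map unbarred (cofactors S i))) _ ⟩
    + length (map unbarred (cofactors S i)) + + length (map barred (cofactorsAbove 1 S i))
      ≡⟨ cong₂ (λ x y → + x + + y) (LP.length-map unbarred (cofactors S i)) (LP.length-map barred (cofactorsAbove 1 S i)) ⟩
    + length (cofactors S i) + + length (cofactorsAbove 1 S i)
      ≡⟨ cong₂ _+_ (trans (length-cofactors S i) (sym (coeff (⊛-identityˡ (geom (+ 1) S)) i)))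
                   (trans (length-cofactorsAbove 1 S i) (cong (λ e → (mono (+ 1) e ⊛ geom (+ 1) S) i) (ℕP.*-identityˡ S))) ⟩
    (oneS ⊛ geom (+ 1) S) i + (mono (+ 1) S ⊛ geom (+ 1) S) i
      ≡⟨ coeff (⊛-distribʳ-⊕ oneS (mono (+ 1) S) (geom (+ 1) S)) i ⟨
    (classFactor other S ⊛ geom (+ 1) S) i ∎
    where open ≡-Reasoning

-- The generating function (1 + q^S)/(1 − q^S) of the parts of size S of an overpartition.
overpartitionFactor : ℕ → FPS
overpartitionFactor S = (oneS ⊕ mono (+ 1) S) ⊛ geom (+ 1) S

⊛-geom-split : ∀ S X → 1 ≤ S → X ⊛ geom (+ 1) S ≈ overpartitionFactor S ⊛ (geom (- + 1) S ⊛ X)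
⊛-geom-split S X 1≤S = begin
  X ⊛ G                                      ≈⟨ ⊛-comm X G ⟩
  G ⊛ X                                      ≈⟨ ⊛-identityˡ (G ⊛ X) ⟨
  oneS ⊛ (G ⊛ X)                             ≈⟨ ⊛-congˡ (G ⊛ X) (geom-neg-inverse S 1≤S) ⟨
  ((oneS ⊕ mono (+ 1) S) ⊛ G⁻) ⊛ (G ⊛ X)     ≈⟨ ⊛-interchange (oneS ⊕ mono (+ 1) S) G⁻ G X ⟩
  overpartitionFactor S ⊛ (G⁻ ⊛ X)           ∎
  where
  open ≈-Reasoning
  G = geom (+ 1) S
  G⁻ = geom (- + 1) S

negQPoch invQPoch : ℕ → FPS
negQPoch N = prodS (map (λ i → oneS ⊕ mono (+ 1) (suc i)) (upTo N))
invQPoch N = prodS (map (λ i → geom (+ 1) (suc i)) (upTo N))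

upTo↭downFrom : ∀ N → upTo N ↭ downFrom N
upTo↭downFrom N = unique-↭ (Unique.upTo⁺ N) (Unique.downFrom⁺ N) (∈-downFrom⁺ ∘ ∈-upTo⁻) (∈-upTo⁺ ∘ ∈-downFrom⁻)

prodS-overpartitionFactor : ∀ N → prodS (map overpartitionFactor (sizes N)) ≈ negQPoch N ⊛ invQPoch N
prodS-overpartitionFactor N = begin
  prodS (map overpartitionFactor (sizes N))
    ≡⟨ cong prodS (LP.map-∘ (downFrom N)) ⟨
  prodS (map (overpartitionFactor ∘ suc) (downFrom N))
    ≈⟨ prodS-↭ (PermProp.map⁺ (overpartitionFactor ∘ suc) (upTo↭downFrom N)) ⟨
  prodS (map (overpartitionFactor ∘ suc) (upTo N))
    ≈⟨ prodS-map-⊛ (upTo N) (λ i → oneS ⊕ mono (+ 1) (suc i)) (λ i → geom (+ 1) (suc i)) ⟩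
  negQPoch N ⊛ invQPoch N ∎
  where open ≈-Reasoning

pochhammerInf-⊛-upTo : ∀ X N n → n ≤ N →
                  ((negQPochInf ⊛ invQPochInf) ⊛ X) n ≡ ((negQPoch N ⊛ invQPoch N) ⊛ X) n
pochhammerInf-⊛-upTo X N n n≤N = ⊛-cong-upto {g = X} n
  (λ i i≤n → ⊛-cong-upto {negQPochInf} {negQPoch N} {invQPochInf} {invQPoch N} i
    (λ j j≤i → infProd-upTo (λ i → oneS ⊕ mono (+ 1) i) 1+qⁱ-oneBelow N j (≤N j≤i i≤n))
    (λ j j≤i → infProd-upTo (λ i → geom (+ 1) i) geom-oneBelow N j (≤N j≤i i≤n)))
  (λ _ _ → refl)
  where
  ≤N : ∀ {j i} → j ≤ i → i ≤ n → j ≤ N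
  ≤N j≤i i≤n = ℕP.≤-trans j≤i (ℕP.≤-trans i≤n n≤N)
  1+qⁱ-oneBelow : ∀ i → OneBelow (suc i) (oneS ⊕ mono (+ 1) (suc i))
  1+qⁱ-oneBelow i l l<i = trans (cong (_+_ (oneS l)) (mono-≢ (+ 1) (ℕP.>⇒≢ l<i))) (ℤP.+-identityʳ (oneS l))
  geom-oneBelow : ∀ i → OneBelow (suc i) (geom (+ 1) (suc i))
  geom-oneBelow i l l<i = geom-below (+ 1) (suc i) l (s≤s z≤n) l<i

-- Overpartitions with a given mes

module Mes (A a r k : ℕ) (1≤a : 1 ≤ a) (1≤A : 1 ≤ A) where

  R : ℕ
  R = r ∸ 1

  ap : ℕ → ℕ
  ap j = j ℕ.* A ℕ.+ a

  m : ℕ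
  m = ap k

  ap-injective : ∀ {i j} → ap i ≡ ap j → i ≡ j
  ap-injective {i} {j} eq = ℕP.*-cancelʳ-≡ i j A ⦃ ℕ.>-nonZero 1≤A ⦄ (ℕP.+-cancelʳ-≡ a (i ℕ.* A) (j ℕ.* A) eq)

  ap-monoʳ-≤ : ∀ {i j} → i ≤ j → ap i ≤ ap j
  ap-monoʳ-≤ i≤j = ℕP.+-monoˡ-≤ a (ℕP.*-monoˡ-≤ A i≤j)

  ap-monoʳ-< : ∀ {i j} → i < j → ap i < ap j
  ap-monoʳ-< i<j = ℕP.+-monoˡ-< a (ℕP.*-monoˡ-< A ⦃ ℕ.>-nonZero 1≤A ⦄ i<j)

  ap-cancel-< : ∀ {i j} → ap i < ap j → i < j
  ap-cancel-< api<apj = ℕP.≰⇒> λ j≤i → ℕP.<⇒≱ api<apj (ap-monoʳ-≤ j≤i)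

  ap-positive : ∀ j → 1 ≤ ap j
  ap-positive j = ℕP.≤-trans 1≤a (ℕP.m≤n+m a (j ℕ.* A))

  data Position (t : ℕ) : Set where
    at-mes : t ≡ m → Position t
    below-mes : ∀ j → j < k → t ≡ ap j → Position t
    elsewhere : t ≢ m → (∀ j → j < k → t ≢ ap j) → Position t

  position : ∀ t → Position t
  position t with t ℕ.≟ m | ℕP.anyUpTo? (λ j → t ℕ.≟ ap j) k
  ... | yes t≡m | _ = at-mes t≡m
  ... | no _ | yes (j , j<k , t≡apj) = below-mes j j<k t≡apj
  ... | no t≢m | no none = elsewhere t≢m λ j j<k t≡apj → none (j , j<k , t≡apj)

  classify : ∀ {t} → Position t → SizeClass
  classify (at-mes _) = mesSize
  classify (below-mes _ _ _) = belowMes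
  classify (elsewhere _ _) = other

  classOf : ℕ → SizeClass
  classOf t = classify (position t)

  classOf-mes : classOf m ≡ mesSize
  classOf-mes with position m
  ... | at-mes _ = refl
  ... | below-mes j j<k m≡apj = contradiction (ap-injective m≡apj) (ℕP.>⇒≢ j<k)
  ... | elsewhere m≢m _ = contradiction refl m≢m

  classOf-below : ∀ j → j < k → classOf (ap j) ≡ belowMes
  classOf-below j j<k with position (ap j)
  ... | at-mes apj≡m = contradiction (ap-injective apj≡m) (ℕP.<⇒≢ j<k)
  ... | below-mes _ _ _ = refl
  ... | elsewhere _ none = contradiction refl (none j j<k)

  open Blocks R

  open Enumeration (λ t → AllowedIn (classOf t)) (λ S → blocksIn (classOf S) S)
                   (λ S → blocksIn-sound (classOf S) S) (λ S → blocksIn-complete (classOf S) S)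
                   (λ S → blocksIn-unique (classOf S) S) public

  HasMes : ℕ → List Part → Set
  HasMes n π = IsOverpartition π × IsMes r A a π m × InNmes A a m π × weight π ≡ n

  -- Sizes up to n + m suffice: every part is at most n, and the size m must be inspected.
  hasMes⇒admissible : ∀ n π → HasMes n π → Admissible (n ℕ.+ m) n π
  hasMes⇒admissible n π (op , mes , no-bar-below , wπ) = op , parts-≤ , wπ , allowed
    where
    parts-≤ : All (λ p → size p ≤ n ℕ.+ m) π
    parts-≤ = All.map (λ p≤wπ → ℕP.≤-trans p≤wπ (subst (_≤ n ℕ.+ m) (sym wπ) (ℕP.m≤m+n n m))) (parts-≤-weight π)
    no-bar : ∀ j → j < k → hasOverlined (ap j) π ≡ false
    no-bar j j<k = ∉⇒hasOverlined (ap j) π λ apj̄∈π →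
      contradiction (no-bar-below (ap j) true apj̄∈π (j , refl) (ap-monoʳ-< j<k)) λ ()
    enough-copies : ∀ j → j < k → R ≤ countNon (ap j) π
    enough-copies j j<k = ℕP.≮⇒≥ λ few → IsMes.minimal mes (ap j) (j , refl) (ap-monoʳ-< j<k)
                                            (hasOverlined⇒∉ (ap j) π (no-bar j j<k) , few)
    allowed : ∀ t → 1 ≤ t → t ≤ n ℕ.+ m → AllowedIn (classOf t) (blockOf t π)
    allowed t _ _ with position t
    ... | at-mes refl = ∉⇒hasOverlined m π (proj₁ (IsMes.avail mes)) , proj₂ (IsMes.avail mes)
    ... | below-mes j j<k refl = no-bar j j<k , enough-copies j j<k
    ... | elsewhere _ _ = tt

  admissible⇒hasMes : ∀ n π → Admissible (n ℕ.+ m) n π → HasMes n π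
  admissible⇒hasMes n π (op , _ , wπ , allowed) = op , mes , no-bar-below , wπ
    where
    m-allowed : AllowedIn mesSize (blockOf m π)
    m-allowed = subst (λ cl → AllowedIn cl (blockOf m π)) classOf-mes (allowed m (ap-positive k) (ℕP.m≤n+m m n))
    below-allowed : ∀ j → j < k → AllowedIn belowMes (blockOf (ap j) π)
    below-allowed j j<k = subst (λ cl → AllowedIn cl (blockOf (ap j) π)) (classOf-below j j<k)
      (allowed (ap j) (ap-positive j) (ℕP.≤-trans (ℕP.<⇒≤ (ap-monoʳ-< j<k)) (ℕP.m≤n+m m n)))
    mes : IsMes r A a π m
    mes = record
      { cong = k , refl
      ; avail = hasOverlined⇒∉ m π (proj₁ m-allowed) , proj₂ m-allowed
      ; minimal = λ { _ (j , refl) apj<m (_ , few) → ℕP.<⇒≱ few (proj₂ (below-allowed j (ap-cancel-< apj<m))) }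
      }
    no-bar-below : InNmes A a m π
    no-bar-below t false _ _ _ = refl
    no-bar-below t true t̄∈π (j , refl) apj<m =
      contradiction t̄∈π (hasOverlined⇒∉ (ap j) π (proj₁ (below-allowed j (ap-cancel-< apj<m))))

  correction : ℕ → FPS
  correction S = geom (- + 1) S ⊛ classFactor (classOf S) S

  blockCount≈ : ∀ S → 1 ≤ S → blockCount S ≈ overpartitionFactor S ⊛ correction S
  blockCount≈ S 1≤S = ≈-trans (coeffwise λ i → length-blocksIn (classOf S) S i 1≤S)
                              (⊛-geom-split S (classFactor (classOf S) S) 1≤S)

  Constrained : ℕ → Set
  Constrained S = classOf S ≢ other

  constrained? : Decidable Constrained
  constrained? S with classOf S
  ... | mesSize = yes λ ()
  ... | belowMes = yes λ ()
  ... | other = no λ ≢other → ≢other refl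

  correction-unconstrained : ∀ S → 1 ≤ S → ¬ Constrained S → correction S ≈ oneS
  correction-unconstrained S 1≤S unconstrained with classOf S
  ... | mesSize = contradiction (λ ()) unconstrained
  ... | belowMes = contradiction (λ ()) unconstrained
  ... | other = ≈-trans (⊛-comm (geom (- + 1) S) (oneS ⊕ mono (+ 1) S)) (geom-neg-inverse S 1≤S)

  ap-constrained : ∀ j → j ≤ k → Constrained (ap j)
  ap-constrained j j≤k with ℕP.m≤n⇒m<n∨m≡n j≤k
  ... | inj₁ j<k rewrite classOf-below j j<k = λ ()
  ... | inj₂ refl rewrite classOf-mes = λ ()

  constrained-sizes : ∀ N → m ≤ N → filter constrained? (sizes N) ↭ map ap (downFrom (suc k))
  constrained-sizes N m≤N = unique-↭ (Unique.filter⁺ constrained? (Unique-sizes N))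
                                     (Unique.map⁺ ap-injective (Unique.downFrom⁺ (suc k)))
                                     constrained⇒ap ap⇒constrained
    where
    constrained⇒ap : ∀ {S} → S ∈ filter constrained? (sizes N) → S ∈ map ap (downFrom (suc k))
    constrained⇒ap {S} S∈ with position S | proj₂ (∈-filter⁻ constrained? {xs = sizes N} S∈)
    ... | at-mes refl | _ = ∈-map⁺ ap (∈-downFrom⁺ (ℕP.n<1+n k))
    ... | below-mes j j<k refl | _ = ∈-map⁺ ap (∈-downFrom⁺ (ℕP.m≤n⇒m≤1+n j<k))
    ... | elsewhere _ _ | ≢other = contradiction refl ≢other
    ap⇒constrained : ∀ {S} → S ∈ map ap (downFrom (suc k)) → S ∈ filter constrained? (sizes N)
    ap⇒constrained {S} S∈ with ∈-map⁻ ap {S} {downFrom (suc k)} S∈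
    ... | j , j∈ , refl with ℕP.≤-pred (∈-downFrom⁻ j∈)
    ...   | j≤k = ∈-filter⁺ constrained? (∈-sizes⁺ (ap-positive j) (ℕP.≤-trans (ap-monoʳ-≤ j≤k) m≤N))
                                        (ap-constrained j j≤k)

  exponent : ∀ K → sum (map (λ j → R ℕ.* ap j) (downFrom K)) ≡ R ℕ.* (A ℕ.* (K C 2) ℕ.+ K ℕ.* a)
  exponent zero = sym (trans (cong (λ c → R ℕ.* (A ℕ.* c ℕ.+ 0)) (k>n⇒nCk≡0 {0} {2} (s≤s z≤n))) (vanish R A))
    where
    vanish : ∀ R A → R ℕ.* (A ℕ.* 0 ℕ.+ 0) ≡ 0
    vanish = ℕSolver.solve-∀
  exponent (suc K) = begin
    R ℕ.* ap K ℕ.+ sum (map (λ j → R ℕ.* ap j) (downFrom K))    ≡⟨ cong (R ℕ.* ap K ℕ.+_) (exponent K) ⟩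
    R ℕ.* ap K ℕ.+ R ℕ.* (A ℕ.* (K C 2) ℕ.+ K ℕ.* a)             ≡⟨ ℕP.*-distribˡ-+ R (ap K) _ ⟨
    R ℕ.* (ap K ℕ.+ (A ℕ.* (K C 2) ℕ.+ K ℕ.* a))                  ≡⟨ cong (R ℕ.*_) (rearrange A a K (K C 2)) ⟩
    R ℕ.* (A ℕ.* (K ℕ.+ K C 2) ℕ.+ suc K ℕ.* a)                   ≡⟨ cong (λ c → R ℕ.* (A ℕ.* c ℕ.+ suc K ℕ.* a)) (sucK-C-2 K) ⟩
    R ℕ.* (A ℕ.* (suc K C 2) ℕ.+ suc K ℕ.* a)                     ∎
    where
    open ≡-Reasoning
    rearrange : ∀ A a K c → (K ℕ.* A ℕ.+ a) ℕ.+ (A ℕ.* c ℕ.+ K ℕ.* a) ≡ A ℕ.* (K ℕ.+ c) ℕ.+ suc K ℕ.* a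
    rearrange = ℕSolver.solve-∀
    sucK-C-2 : ∀ K → K ℕ.+ K C 2 ≡ suc K C 2
    sucK-C-2 K = trans (cong (ℕ._+ K C 2) (sym (nC1≡n K))) (nCk+nC[k+1]≡[n+1]C[k+1] K 1)

  e₀ e₁ : ℕ
  e₀ = R ℕ.* (A ℕ.* (k C 2) ℕ.+ k ℕ.* a)
  e₁ = R ℕ.* (A ℕ.* (suc k C 2) ℕ.+ suc k ℕ.* a)

  prodS-classFactor : prodS (map (λ j → classFactor (classOf (ap j)) (ap j)) (downFrom (suc k))) ≈
                      mono (+ 1) e₀ ⊖ mono (+ 1) e₁
  prodS-classFactor = begin
    classFactor (classOf m) m ⊛ prodS (map (λ j → classFactor (classOf (ap j)) (ap j)) (downFrom k))
      ≈⟨ ⊛-cong (≡⇒≈ (cong (λ cl → classFactor cl m) classOf-mes))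
                (prodS-map-cong (downFrom k) λ j j∈ →
                  ≡⇒≈ (cong (λ cl → classFactor cl (ap j)) (classOf-below j (∈-downFrom⁻ j∈)))) ⟩
    (oneS ⊖ mono (+ 1) (R ℕ.* m)) ⊛ prodS (map (λ j → mono (+ 1) (R ℕ.* ap j)) (downFrom k))
      ≈⟨ ⊛-congʳ (oneS ⊖ mono (+ 1) (R ℕ.* m)) (prodS-map-mono (λ j → R ℕ.* ap j) (downFrom k)) ⟩
    (oneS ⊖ mono (+ 1) (R ℕ.* m)) ⊛ mono (+ 1) E
      ≈⟨ ⊛-distribʳ-⊖ oneS (mono (+ 1) (R ℕ.* m)) (mono (+ 1) E) ⟩
    (oneS ⊛ mono (+ 1) E) ⊖ (mono (+ 1) (R ℕ.* m) ⊛ mono (+ 1) E)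
      ≈⟨ coeffwise (λ n → cong₂ _-_ (coeff (⊛-identityˡ (mono (+ 1) E)) n) (coeff (mono-⊛-mono (R ℕ.* m) E) n)) ⟩
    mono (+ 1) E ⊖ mono (+ 1) (R ℕ.* m ℕ.+ E)
      ≡⟨ cong₂ (λ x y → mono (+ 1) x ⊖ mono (+ 1) y) (exponent k) (exponent (suc k)) ⟩
    mono (+ 1) e₀ ⊖ mono (+ 1) e₁ ∎
    where
    open ≈-Reasoning
    E = sum (map (λ j → R ℕ.* ap j) (downFrom k))

  prodS-geom-ap : prodS (map (geom (- + 1) ∘ ap) (downFrom (suc k))) ≈ invNegPoch A a k
  prodS-geom-ap = begin
    prodS (map (geom (- + 1) ∘ ap) (downFrom (suc k)))
      ≈⟨ prodS-↭ (PermProp.map⁺ (geom (- + 1) ∘ ap) (upTo↭downFrom (suc k))) ⟨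
    prodS (map (geom (- + 1) ∘ ap) (upTo (suc k)))
      ≈⟨ prodS-map-cong (upTo (suc k)) (λ i _ → ≡⇒≈ (cong (geom (- + 1)) (ℕP.+-comm (i ℕ.* A) a))) ⟩
    invNegPoch A a k ∎
    where open ≈-Reasoning

  prodS-correction : ∀ N → m ≤ N → prodS (map correction (sizes N)) ≈ (mono (+ 1) e₀ ⊖ mono (+ 1) e₁) ⊛ invNegPoch A a k
  prodS-correction N m≤N = begin
    prodS (map correction (sizes N))
      ≈⟨ prodS-map-filter constrained? correction (sizes N) (λ S S∈ → correction-unconstrained S (∈-sizes⁻ S∈)) ⟩
    prodS (map correction (filter constrained? (sizes N)))
      ≈⟨ prodS-↭ (PermProp.map⁺ correction (constrained-sizes N m≤N)) ⟩
    prodS (map correction (map ap (downFrom (suc k))))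
      ≡⟨ cong prodS (LP.map-∘ {g = correction} {f = ap} (downFrom (suc k))) ⟨
    prodS (map (λ j → geom (- + 1) (ap j) ⊛ classFactor (classOf (ap j)) (ap j)) (downFrom (suc k)))
      ≈⟨ prodS-map-⊛ (downFrom (suc k)) (geom (- + 1) ∘ ap) (λ j → classFactor (classOf (ap j)) (ap j)) ⟩
    prodS (map (geom (- + 1) ∘ ap) (downFrom (suc k))) ⊛ prodS (map (λ j → classFactor (classOf (ap j)) (ap j)) (downFrom (suc k)))
      ≈⟨ ⊛-cong prodS-geom-ap prodS-classFactor ⟩
    invNegPoch A a k ⊛ (mono (+ 1) e₀ ⊖ mono (+ 1) e₁)
      ≈⟨ ⊛-comm (invNegPoch A a k) (mono (+ 1) e₀ ⊖ mono (+ 1) e₁) ⟩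
    (mono (+ 1) e₀ ⊖ mono (+ 1) e₁) ⊛ invNegPoch A a k ∎
    where open ≈-Reasoning

  length-enumerate : ∀ n → + length (enumerate (n ℕ.+ m) n) ≡ rhsTerm r A a k n
  length-enumerate n = begin
    + length (enumerate N n)
      ≡⟨ enumerate-count N n ⟩
    prodS (map blockCount (sizes N)) n
      ≡⟨ coeff (prodS-map-cong (sizes N) λ S S∈ → blockCount≈ S (∈-sizes⁻ S∈)) n ⟩
    prodS (map (λ S → overpartitionFactor S ⊛ correction S) (sizes N)) n
      ≡⟨ coeff (prodS-map-⊛ (sizes N) overpartitionFactor correction) n ⟩
    (prodS (map overpartitionFactor (sizes N)) ⊛ prodS (map correction (sizes N))) n
      ≡⟨ coeff (⊛-cong (prodS-overpartitionFactor N) (prodS-correction N (ℕP.m≤n+m m n))) n ⟩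
    ((negQPoch N ⊛ invQPoch N) ⊛ ((mono (+ 1) e₀ ⊖ mono (+ 1) e₁) ⊛ invNegPoch A a k)) n
      ≡⟨ pochhammerInf-⊛-upTo ((mono (+ 1) e₀ ⊖ mono (+ 1) e₁) ⊛ invNegPoch A a k) N n (ℕP.m≤m+n n m) ⟨
    rhsTerm r A a k n ∎
    where
    open ≡-Reasoning
    N = n ℕ.+ m

  rhsCoeff-mes : ∀ n → rhsCoeff r A a m n ≡ rhsTerm r A a k n
  rhsCoeff-mes n = begin
    rhsCoeff r A a m n   ≡⟨ sumℤ-map-upTo (suc m) term ⟩
    ∑ (suc m) term       ≡⟨ ∑-single (suc m) k term (s≤s (≤-ap k)) (λ i _ i≢k →
                              cong (λ b → if b then rhsTerm r A a i n else + 0) (≡ᵇ-false (i≢k ∘ ap-injective))) ⟩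
    term k               ≡⟨ cong (λ b → if b then rhsTerm r A a k n else + 0) (≡ᵇ-true (refl {x = m})) ⟩
    rhsTerm r A a k n    ∎
    where
    open ≡-Reasoning
    term : ℕ → ℤ
    term i = if ap i ≡ᵇ m then rhsTerm r A a i n else + 0
    ≤-ap : ∀ j → j ≤ ap j
    ≤-ap j = ℕP.≤-trans (ℕP.m≤m*n j A ⦃ ℕ.>-nonZero 1≤A ⦄) (ℕP.m≤m+n (j ℕ.* A) a)

rhsCoeff-incongruent : ∀ r A a m n → ¬ CongPos A a m → rhsCoeff r A a m n ≡ + 0
rhsCoeff-incongruent r A a m n incongruent =
  trans (sumℤ-map-upTo (suc m) (λ k → if k ℕ.* A ℕ.+ a ≡ᵇ m then rhsTerm r A a k n else + 0))
  (∑-zero (suc m) λ k _ → cong (λ b → if b then rhsTerm r A a k n else + 0) (≡ᵇ-false λ eq → incongruent (k , sym eq)))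

congPos? : ∀ A a m → 1 ≤ A → Dec (CongPos A a m)
congPos? A a m 1≤A with ℕP.anyUpTo? (λ k → m ℕ.≟ k ℕ.* A ℕ.+ a) (suc m)
... | yes (k , _ , m≡kA+a) = yes (k , m≡kA+a)
... | no none = no λ (k , m≡kA+a) → none (k , s≤s (k≤m k m≡kA+a) , m≡kA+a)
  where
  k≤m : ∀ k → m ≡ k ℕ.* A ℕ.+ a → k ≤ m
  k≤m k refl = ℕP.≤-trans (ℕP.m≤m*n k A ⦃ ℕ.>-nonZero 1≤A ⦄) (ℕP.m≤m+n (k ℕ.* A) a)

theorem2p10 : (A a r : ℕ) → 1 ≤ a → a ≤ A → 2 ≤ r →
    (m n : ℕ) →
      ∃[ L ] (Unique L ×
        (∀ (π : List Part) → (π ∈ L) ⇔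
          (IsOverpartition π × IsMes r A a π m × InNmes A a m π × weight π ≡ n)) ×
        (+ length L ≡ rhsCoeff r A a m n))
theorem2p10 A a r 1≤a a≤A _ m n with congPos? A a m (ℕP.≤-trans 1≤a a≤A)
... | yes (k , refl) =
  enumerate (n ℕ.+ ap k) n ,
  enumerate-unique (n ℕ.+ ap k) n ,
  (λ π → mk⇔ (admissible⇒hasMes n π ∘ enumerate-sound (n ℕ.+ ap k) n π)
             (enumerate-complete (n ℕ.+ ap k) n π ∘ hasMes⇒admissible n π)) ,
  trans (length-enumerate n) (sym (rhsCoeff-mes n))
  where open Mes A a r k 1≤a (ℕP.≤-trans 1≤a a≤A) hiding (m)
... | no incongruent =
  [] , [] , (λ π → mk⇔ (λ ()) λ (_ , mes , _) → contradiction (IsMes.cong mes) incongruent) ,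
  sym (rhsCoeff-incongruent r A a m n incongruent)
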